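{- Let $Z$ be a finite set of integers that is the imbalance set of some tournament, and let $\mathrm{ord}(Z)$ denote the minimal order of a tournament with imbalance set $Z$. Let $X=\{x_1,\ldots,x_l\}$ be the set of non-negative elements of $Z$ and $Y=\{ -y_1,\ldots,-y_m\}$ the set of negative elements of $Z$, let $L=\sum_{i=1}^{l}x_i$, $M=\sum_{i=1}^{m}y_i$ and $n=lM+mL$. (i) If $Z$ consists of odd integers, then $\mathrm{ord}(Z)\leq n$. (ii) If $Z$ consists of even integers and $0\in Z$, then $\mathrm{ord}(Z)\leq n+1$. (iii) If $Z$ consists of even integers and $0\notin Z$, then $\mathrm{ord}(Z)<2n$.
   Context: A tournament is an orientation of a complete simple graph; its order is its number of vertices. The imbalance of a vertex $v$ in a digraph is $d^{+}(v)-d^{ - }(v)$ (outdegree minus indegree), and the imbalance set of a digraph is the set of imbalances of its vertices. -}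

module Defs where

open import Data.Nat as ℕ using (ℕ; suc)
open import Data.Integer as ℤ using (ℤ; +_; _-_; _+_; _*_; -_; _≤_; _<_; _≤ᵇ_)
open import Data.Bool using (Bool; true; false; not)
open import Data.Fin using (Fin)
open import Data.List using (List; length; filterᵇ; foldr)
open import Data.List.Membership.Propositional using (_∈_)
open import Data.Product using (Σ; ∃; _×_)
open import Function.Bundles using (_⇔_)
open import Relation.Binary.PropositionalEquality using (_≡_; _≢_)

-- A tournament of order k: an orientation of the complete simple graph on Fin k.
-- arc i j ≡ true means the edge {i,j} is oriented i → j.
record Tournament (k : ℕ) : Set where
  field
    arc     : Fin k → Fin k → Bool
    irrefl  : ∀ i → arc i i ≡ false
    orient  : ∀ i j → i ≢ j → arc j i ≡ not (arc i j)
open Tournament public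

allFin : (k : ℕ) → List (Fin k)
allFin k = Data.List.allFin k

outdeg : ∀ {k} → Tournament k → Fin k → ℕ
outdeg {k} T v = length (filterᵇ (λ w → arc T v w) (allFin k))

indeg : ∀ {k} → Tournament k → Fin k → ℕ
indeg {k} T v = length (filterᵇ (λ w → arc T w v) (allFin k))

imbalance : ∀ {k} → Tournament k → Fin k → ℤ
imbalance T v = + outdeg T v - + indeg T v

IsImbalanceSetOf : List ℤ → ∀ {k} → Tournament k → Set
IsImbalanceSetOf Z {k} T = ∀ z → (z ∈ Z) ⇔ (∃ λ (v : Fin k) → imbalance T v ≡ z)

Realizable : List ℤ → Set
Realizable Z = ∃ λ k → Σ (Tournament (suc k)) (IsImbalanceSetOf Z)

IsOrd : List ℤ → ℕ → Set
IsOrd Z o =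
  (∃ λ k → Σ (Tournament (suc k)) (IsImbalanceSetOf Z) × (suc k ≡ o))
  × (∀ k → (T : Tournament (suc k)) → IsImbalanceSetOf Z T → o ℕ.≤ suc k)

EvenInt OddInt : ℤ → Set
EvenInt z = ∃ λ t → z ≡ + 2 * t
OddInt  z = ∃ λ t → z ≡ + 1 + + 2 * t

nonneg : List ℤ → List ℤ
nonneg = filterᵇ (λ z → + 0 ≤ᵇ z)

neg : List ℤ → List ℤ
neg = filterᵇ (λ z → not (+ 0 ≤ᵇ z))

lX mY : List ℤ → ℕ
lX Z = length (nonneg Z)
mY Z = length (neg Z)

sumℤ : List ℤ → ℤ
sumℤ = foldr _+_ (+ 0)

LX MY : List ℤ → ℤ
LX Z = sumℤ (nonneg Z)
MY Z = - sumℤ (neg Z)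

nOf : List ℤ → ℤ
nOf Z = + lX Z * MY Z + + mY Z * LX Z

module Submission where

-- For a pair (x, y) ∈ X × Y, a
-- (near-)regular tournament on |y| vertices beating every vertex of a (near-)regular tournament on
-- x vertices has imbalances x and y and x − y vertices; over all pairs these add up to n = lM + mL.
-- The pieces are glued using ±1 labels: a vertex beats a vertex of another piece iff their labels
-- agree, which shifts imbalances by σ(label) times the label sum of the other piece, and these sums
-- vanish. For odd Z regular pieces exist, giving (i). For even Z the near-regular pieces are off by
-- the sign of their labels; one further piece of label sum 1 corrects that: a single vertex of
-- imbalance 0 when 0 ∈ Z, giving (ii). When 0 ∉ Z some pair has 2-adic valuations differing, since
-- equal valuations e would make the imbalances 2^e times odd numbers with sum 0, forcing even order,
-- while even imbalances force odd order. Such a pair has {x, −y} = {2d·c, 2d·t} with t odd and c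
-- even, and blowing up the regular tournament on 2d + 1 vertices by a piece with c vertices of one
-- type and t of the other (reversed if necessary) realises exactly {x, y} on (2d + 1)(t + c)
-- vertices, fewer than 2(x − y). It replaces the piece of that pair and, having label sum 1,
-- corrects the labels, giving (iii).

open import Defs
open import Data.Nat using (ℕ)
open import Data.Integer using (ℤ; +_; _≤_; _<_; _*_; _+_)
open import Data.List using (List)
open import Data.List.Relation.Unary.Unique.Propositional using (Unique)
open import Data.List.Relation.Unary.All using (All)
open import Data.List.Membership.Propositional using (_∈_; _∉_)
open import Data.Product using (_×_)

import Data.Integer.Properties as ℤ
open import Algebra.Properties.CommutativeSemigroup ℤ.+-commutativeSemigroup using (interchange)
open import Algebra.Properties.Semiring.Sum ℤ.+-*-semiring
  using (sum; sum-syntax; sum-cong-≗; *-distribˡ-sum; *-distribʳ-sum)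
open import Data.Bool using (Bool; true; false; not; if_then_else_; T)
open import Data.Bool.Properties using (not-involutive)
open import Data.Empty using (⊥; ⊥-elim)
open import Data.Fin using (Fin; zero; suc; _↑ˡ_; _↑ʳ_; _≟_; combine; quotient; remainder)
import Data.Fin.Properties as Finₚ
open import Data.Integer using (-_; _-_; -[1+_]; ∣_∣; +<+; +≤+; -<+; _≤ᵇ_)
open import Data.Integer.Tactic.RingSolver using (solve-∀)
open import Data.List using ([]; _∷_; length; filterᵇ; tabulate; map; foldr; cartesianProduct)
import Data.List as List
open import Data.List.Membership.Propositional using (find)
import Data.List.Membership.Propositional.Properties as ∈ₚ
import Data.List.Relation.Unary.All as All
open import Data.List.Relation.Unary.All.Properties.Core using (¬All⇒Any¬)
open import Data.List.Relation.Unary.Any using (here; there)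
open import Data.Nat using (zero; suc; _^_; ⌊_/2⌋)
import Data.Nat as ℕ
open import Data.Nat.Induction using (<-rec)
import Data.Nat.Properties as ℕₚ
import Data.Nat.Tactic.RingSolver as ℕ-Solver
open import Data.Product using (∃; ∃₂; _,_; proj₁; proj₂; map₂)
open import Data.Sum using (_⊎_; inj₁; inj₂)
import Data.Sum as Sum
open import Data.Unit using (tt)
open import Data.Vec.Functional using (Vector; _++_)
open import Data.Vec.Functional.Properties using (lookup-++ˡ; lookup-++ʳ)
open import Function using (_∘_; id)
open import Function.Bundles using (mk⇔; Equivalence)
open import Relation.Binary.Definitions using (Tri; tri<; tri≈; tri>)
open import Relation.Binary.PropositionalEquality
open import Relation.Nullary using (yes; no; does; Dec)
open import Relation.Nullary.Decidable using (T?)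

⟦_⟧ : Bool → ℤ
⟦ true ⟧ = + 1
⟦ false ⟧ = + 0

σ : Bool → ℤ
σ true = + 1
σ false = - + 1

⟦⟧-⟦not⟧ : ∀ b → ⟦ b ⟧ - ⟦ not b ⟧ ≡ σ b
⟦⟧-⟦not⟧ true = refl
⟦⟧-⟦not⟧ false = refl

⟦not⟧-⟦⟧ : ∀ b → ⟦ not b ⟧ - ⟦ b ⟧ ≡ - σ b
⟦not⟧-⟦⟧ true = refl
⟦not⟧-⟦⟧ false = refl

σ-not : ∀ b → σ (not b) ≡ - σ b
σ-not true = refl
σ-not false = refl

_≡ᵇ_ : Bool → Bool → Bool
true ≡ᵇ b = b
false ≡ᵇ b = not b

σ-≡ᵇ : ∀ a b → σ (a ≡ᵇ b) ≡ σ a * σ b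
σ-≡ᵇ true true = refl
σ-≡ᵇ true false = refl
σ-≡ᵇ false true = refl
σ-≡ᵇ false false = refl

↑-elim : ∀ p {q} {P : Fin (p ℕ.+ q) → Set} →
  (∀ a → P (a ↑ˡ q)) → (∀ b → P (p ↑ʳ b)) → ∀ i → P i
↑-elim zero l r i = r i
↑-elim (suc p) l r zero = l zero
↑-elim (suc p) l r (suc i) = ↑-elim p (l ∘ suc) r i

++-values : ∀ {A : Set} {p q} (xs : Vector A p) (ys : Vector A q) v →
  (∃ λ a → xs a ≡ (xs ++ ys) v) ⊎ (∃ λ b → ys b ≡ (xs ++ ys) v)
++-values {p = p} xs ys = ↑-elim p (λ a → inj₁ (a , sym (lookup-++ˡ xs ys a)))
                                   (λ b → inj₂ (b , sym (lookup-++ʳ xs ys b)))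

sum-↑ : ∀ p {q} (f : Fin (p ℕ.+ q) → ℤ) →
  sum f ≡ sum (f ∘ (_↑ˡ q)) + sum (f ∘ (p ↑ʳ_))
sum-↑ zero f = sym (ℤ.+-identityˡ _)
sum-↑ (suc p) {q} f = trans (cong (_+_ (f zero)) (sum-↑ p (f ∘ suc)))
  (sym (ℤ.+-assoc (f zero) (sum (f ∘ suc ∘ (_↑ˡ q))) (sum (f ∘ (suc p ↑ʳ_)))))

sum-++ : ∀ {A : Set} {p q} (h : A → ℤ) (xs : Vector A p) (ys : Vector A q) →
  sum (h ∘ (xs ++ ys)) ≡ sum (h ∘ xs) + sum (h ∘ ys)
sum-++ {p = p} h xs ys = trans (sum-↑ p _)
  (cong₂ _+_ (sum-cong-≗ (cong h ∘ lookup-++ˡ xs ys)) (sum-cong-≗ (cong h ∘ lookup-++ʳ xs ys)))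

sum-+ : ∀ {n} (f g : Fin n → ℤ) → ∑[ i < n ] (f i + g i) ≡ sum f + sum g
sum-+ {zero} f g = refl
sum-+ {suc n} f g =
  trans (cong (_+_ (f zero + g zero)) (sum-+ (f ∘ suc) (g ∘ suc)))
        (interchange (f zero) (g zero) (sum (f ∘ suc)) (sum (g ∘ suc)))

sum-neg : ∀ {n} (f : Fin n → ℤ) → ∑[ i < n ] (- f i) ≡ - sum f
sum-neg {zero} f = refl
sum-neg {suc n} f =
  trans (cong (_+_ (- f zero)) (sum-neg (f ∘ suc))) (sym (ℤ.neg-distrib-+ (f zero) _))

sum-sub : ∀ {n} (f g : Fin n → ℤ) → ∑[ i < n ] (f i - g i) ≡ sum f - sum g
sum-sub f g = trans (sum-+ f (-_ ∘ g)) (cong (_+_ (sum f)) (sum-neg g))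

sum-const : ∀ n c → ∑[ i < n ] c ≡ + n * c
sum-const zero c = sym (ℤ.*-zeroˡ c)
sum-const (suc n) c = trans (cong (_+_ c) (sum-const n c)) (sym (ℤ.suc-* (+ n) c))

sum-swap : ∀ {m n} (f : Fin m → Fin n → ℤ) →
  ∑[ i < m ] sum (f i) ≡ ∑[ j < n ] ∑[ i < m ] f i j
sum-swap {zero} {n} f = sym (trans (sum-const n (+ 0)) (ℤ.*-zeroʳ (+ n)))
sum-swap {suc m} f = trans (cong (_+_ (sum (f zero))) (sum-swap (f ∘ suc))) (sym (sum-+ (f zero) _))

sum-combine : ∀ {m n} (f : Fin (m ℕ.* n) → ℤ) → sum f ≡ ∑[ i < m ] ∑[ j < n ] f (combine i j)
sum-combine {zero} f = refl
sum-combine {suc m} {n} f =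
  trans (sum-↑ n f) (cong (_+_ (sum (f ∘ (_↑ˡ m ℕ.* n)))) (sum-combine {m} {n} (f ∘ (n ↑ʳ_))))

0≤sum : ∀ {n} (f : Fin n → ℤ) → (∀ w → + 0 ≤ f w) → + 0 ≤ sum f
0≤sum {zero} f _ = ℤ.≤-refl
0≤sum {suc n} f 0≤f = ℤ.+-mono-≤ (0≤f zero) (0≤sum (f ∘ suc) (0≤f ∘ suc))

term≤sum : ∀ {n} (f : Fin n → ℤ) → (∀ w → + 0 ≤ f w) → ∀ v → f v ≤ sum f
term≤sum f 0≤f zero = ℤ.≤-trans (ℤ.≤-reflexive (sym (ℤ.+-identityʳ (f zero))))
  (ℤ.+-monoʳ-≤ (f zero) (0≤sum (f ∘ suc) (0≤f ∘ suc)))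
term≤sum f 0≤f (suc v) = ℤ.≤-trans (term≤sum (f ∘ suc) (0≤f ∘ suc) v)
  (ℤ.≤-trans (ℤ.≤-reflexive (sym (ℤ.+-identityˡ _))) (ℤ.+-monoˡ-≤ (sum (f ∘ suc)) (0≤f zero)))

sum≡0⇒negative : ∀ {n} (f : Fin n → ℤ) → sum f ≡ + 0 → ∀ v → + 0 < f v → ∃ λ w → f w < + 0
sum≡0⇒negative f sum≡0 v 0<fv with Finₚ.any? (λ w → f w ℤ.<? + 0)
... | yes negative = negative
... | no none = ⊥-elim (ℤ.<-irrefl refl (ℤ.<-≤-trans 0<fv
      (ℤ.≤-trans (term≤sum f (λ w → ℤ.≮⇒≥ (λ fw<0 → none (w , fw<0))) v) (ℤ.≤-reflexive sum≡0))))

sum≡0⇒positive : ∀ {n} (f : Fin n → ℤ) → sum f ≡ + 0 → ∀ v → f v < + 0 → ∃ λ w → + 0 < f w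
sum≡0⇒positive f sum≡0 v fv<0 =
  let (w , -fw<0) = sum≡0⇒negative (-_ ∘ f) (trans (sum-neg f) (cong -_ sum≡0)) v (ℤ.neg-mono-< fv<0)
  in w , ℤ.neg-cancel-< -fw<0

weight : ∀ {k} → (Fin k → Bool) → ℤ
weight {k} g = ∑[ i < k ] σ (g i)

weight-++ : ∀ {p q} (g₁ : Vector Bool p) (g₂ : Vector Bool q) → weight (g₁ ++ g₂) ≡ weight g₁ + weight g₂
weight-++ = sum-++ σ

weight-combine : ∀ {m k} (g : Fin m → Bool) (h : Fin k → Bool) →
  weight (λ v → g (quotient k v) ≡ᵇ h (remainder {m} k v)) ≡ weight g * weight h
weight-combine {m} {k} g h = begin
  weight (λ v → g (quotient k v) ≡ᵇ h (remainder {m} k v))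
    ≡⟨ sum-combine {m} {k} _ ⟩
  ∑[ i < m ] ∑[ j < k ] σ (g (quotient k (combine i j)) ≡ᵇ h (remainder {m} k (combine i j)))
    ≡⟨ sum-cong-≗ (λ i → sum-cong-≗ λ j →
         trans (cong (λ p → σ (g (proj₁ p) ≡ᵇ h (proj₂ p))) (Finₚ.remQuot-combine i j)) (σ-≡ᵇ (g i) (h j))) ⟩
  ∑[ i < m ] ∑[ j < k ] (σ (g i) * σ (h j))
    ≡⟨ sum-cong-≗ (λ i → sym (*-distribˡ-sum {k} (σ (g i)) (σ ∘ h))) ⟩
  ∑[ i < m ] (σ (g i) * weight h)
    ≡⟨ sym (*-distribʳ-sum {m} (weight h) (σ ∘ g)) ⟩
  weight g * weight h ∎
  where open ≡-Reasoning

imb : ∀ {k} → Tournament k → Fin k → ℤ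
imb {k} T v = ∑[ w < k ] (⟦ arc T v w ⟧ - ⟦ arc T w v ⟧)

count-filterᵇ : ∀ {A : Set} {k} (p : A → Bool) (g : Fin k → A) →
  + length (filterᵇ p (tabulate g)) ≡ ∑[ i < k ] ⟦ p (g i) ⟧
count-filterᵇ {k = zero} p g = refl
count-filterᵇ {k = suc k} p g with p (g zero)
... | true = trans (ℤ.pos-+ 1 _) (cong (_+_ (+ 1)) (count-filterᵇ p (g ∘ suc)))
... | false = trans (count-filterᵇ p (g ∘ suc)) (sym (ℤ.+-identityˡ _))

imbalance≡imb : ∀ {k} (T : Tournament k) v → imbalance T v ≡ imb T v
imbalance≡imb {k} T v =
  trans (cong₂ _-_ (count-filterᵇ (arc T v) id) (count-filterᵇ (λ w → arc T w v) id))
        (sym (sum-sub {k} (λ w → ⟦ arc T v w ⟧) (λ w → ⟦ arc T w v ⟧)))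

x≡-x⇒x≡0 : ∀ {x} → x ≡ - x → x ≡ + 0
x≡-x⇒x≡0 {+ zero} _ = refl
x≡-x⇒x≡0 {+ suc n} ()
x≡-x⇒x≡0 { -[1+ n ]} ()

sum-imb : ∀ {k} (T : Tournament k) → ∑[ v < k ] imb T v ≡ + 0
sum-imb {k} T = x≡-x⇒x≡0 (begin
  ∑[ v < k ] imb T v
    ≡⟨ sum-swap d ⟩
  ∑[ w < k ] ∑[ v < k ] d v w
    ≡⟨ sum-cong-≗ (λ w → trans (sum-cong-≗ (λ v → antisym v w)) (sum-neg (d w))) ⟩
  ∑[ w < k ] (- imb T w)
    ≡⟨ sum-neg (imb T) ⟩
  - ∑[ v < k ] imb T v ∎)
  where
  open ≡-Reasoning
  d : Fin k → Fin k → ℤ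
  d v w = ⟦ arc T v w ⟧ - ⟦ arc T w v ⟧
  antisym : ∀ v w → d v w ≡ - d w v
  antisym v w = flip-sub ⟦ arc T v w ⟧ ⟦ arc T w v ⟧
    where flip-sub : ∀ a b → a - b ≡ - (b - a)
          flip-sub = solve-∀

sum-δ : ∀ {n} (v : Fin n) → ∑[ w < n ] ⟦ does (w ≟ v) ⟧ ≡ + 1
sum-δ {suc n} zero = cong (_+_ (+ 1)) (trans (sum-const n (+ 0)) (ℤ.*-zeroʳ (+ n)))
sum-δ {suc n} (suc v) = trans (ℤ.+-identityˡ _) (sum-δ v)

arcs-between : ∀ {k} (T : Tournament k) v w →
  ⟦ arc T v w ⟧ + ⟦ arc T w v ⟧ + ⟦ does (w ≟ v) ⟧ ≡ + 1
arcs-between T v w with w ≟ v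
... | yes refl rewrite irrefl T v = refl
... | no w≢v rewrite orient T v w (w≢v ∘ sym) = exactly-one (arc T v w)
  where
  exactly-one : ∀ b → ⟦ b ⟧ + ⟦ not b ⟧ + + 0 ≡ + 1
  exactly-one true = refl
  exactly-one false = refl

imb≡order-2indeg : ∀ {k} (T : Tournament (suc k)) v →
  imb T v ≡ + k - + 2 * ∑[ w < suc k ] ⟦ arc T w v ⟧
imb≡order-2indeg {k} T v = begin
  imb T v
    ≡⟨ sum-cong-≗ (λ w → regroup (out w) (in′ w) (δ w)) ⟩
  ∑[ w < suc k ] ((out w + in′ w + δ w) - (δ w + + 2 * in′ w))
    ≡⟨ sum-sub {suc k} (λ w → out w + in′ w + δ w) (λ w → δ w + + 2 * in′ w) ⟩
  ∑[ w < suc k ] (out w + in′ w + δ w) - ∑[ w < suc k ] (δ w + + 2 * in′ w)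
    ≡⟨ cong₂ _-_ (trans (sum-cong-≗ (arcs-between T v)) (sum-const (suc k) (+ 1)))
                 (trans (sum-+ δ (λ w → + 2 * in′ w))
                        (cong₂ _+_ (sum-δ v) (sym (*-distribˡ-sum (+ 2) in′)))) ⟩
  + suc k * + 1 - (+ 1 + + 2 * sum in′)
    ≡⟨ cancel (+ k) (sum in′) ⟩
  + k - + 2 * sum in′ ∎
  where
  open ≡-Reasoning
  out in′ δ : Fin (suc k) → ℤ
  out w = ⟦ arc T v w ⟧
  in′ w = ⟦ arc T w v ⟧
  δ w = ⟦ does (w ≟ v) ⟧
  regroup : ∀ a b d → a - b ≡ (a + b + d) - (d + + 2 * b)
  regroup = solve-∀
  cancel : ∀ k i → (+ 1 + k) * + 1 - (+ 1 + + 2 * i) ≡ k - + 2 * i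
  cancel = solve-∀

even-imb⇒odd-order : ∀ {k} (T : Tournament (suc k)) v → EvenInt (imb T v) → EvenInt (+ k)
even-imb⇒odd-order {k} T v (t , imb≡2t) = t + i , (begin
  + k                   ≡⟨ shift (+ k) i ⟩
  (+ k - + 2 * i) + + 2 * i ≡⟨ cong (λ x → x + + 2 * i) (trans (sym (imb≡order-2indeg T v)) imb≡2t) ⟩
  + 2 * t + + 2 * i     ≡⟨ sym (ℤ.*-distribˡ-+ (+ 2) t i) ⟩
  + 2 * (t + i)         ∎)
  where
  open ≡-Reasoning
  i = ∑[ w < suc k ] ⟦ arc T w v ⟧
  shift : ∀ k i → k ≡ (k - + 2 * i) + + 2 * i
  shift = solve-∀

-- Gluing, reversing and blowing up tournaments

module Glue {p q} (T₁ : Tournament p) (T₂ : Tournament q) (f : Fin p → Fin q → Bool) where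

  rowˡ : Fin p → Vector Bool (p ℕ.+ q)
  rowˡ a = arc T₁ a ++ f a

  rowʳ : Fin q → Vector Bool (p ℕ.+ q)
  rowʳ b = (λ a → not (f a b)) ++ arc T₂ b

  arcs : Fin (p ℕ.+ q) → Fin (p ℕ.+ q) → Bool
  arcs = rowˡ ++ rowʳ

  arcs-ˡˡ : ∀ a a′ → arcs (a ↑ˡ q) (a′ ↑ˡ q) ≡ arc T₁ a a′
  arcs-ˡˡ a a′ = trans (cong-app (lookup-++ˡ rowˡ rowʳ a) _) (lookup-++ˡ (arc T₁ a) (f a) a′)

  arcs-ˡʳ : ∀ a b → arcs (a ↑ˡ q) (p ↑ʳ b) ≡ f a b
  arcs-ˡʳ a b = trans (cong-app (lookup-++ˡ rowˡ rowʳ a) _) (lookup-++ʳ (arc T₁ a) (f a) b)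

  arcs-ʳˡ : ∀ a b → arcs (p ↑ʳ b) (a ↑ˡ q) ≡ not (f a b)
  arcs-ʳˡ a b =
    trans (cong-app (lookup-++ʳ rowˡ rowʳ b) _) (lookup-++ˡ (λ a → not (f a b)) (arc T₂ b) a)

  arcs-ʳʳ : ∀ b b′ → arcs (p ↑ʳ b) (p ↑ʳ b′) ≡ arc T₂ b b′
  arcs-ʳʳ b b′ =
    trans (cong-app (lookup-++ʳ rowˡ rowʳ b) _) (lookup-++ʳ (λ a → not (f a b)) (arc T₂ b) b′)

  glue : Tournament (p ℕ.+ q)
  glue = record
    { arc = arcs
    ; irrefl = ↑-elim p (λ a → trans (arcs-ˡˡ a a) (irrefl T₁ a))
                        (λ b → trans (arcs-ʳʳ b b) (irrefl T₂ b))
    ; orient = ↑-elim p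
        (λ a → ↑-elim p
          (λ a′ a≢a′ → trans (arcs-ˡˡ a′ a) (trans (orient T₁ a a′ (a≢a′ ∘ cong (_↑ˡ q)))
                                                    (cong not (sym (arcs-ˡˡ a a′)))))
          (λ b _ → trans (arcs-ʳˡ a b) (cong not (sym (arcs-ˡʳ a b)))))
        (λ b → ↑-elim p
          (λ a _ → trans (arcs-ˡʳ a b) (trans (sym (not-involutive _)) (cong not (sym (arcs-ʳˡ a b)))))
          (λ b′ b≢b′ → trans (arcs-ʳʳ b′ b) (trans (orient T₂ b b′ (b≢b′ ∘ cong (p ↑ʳ_)))
                                                    (cong not (sym (arcs-ʳʳ b b′))))))
    }

  imb-glue-ˡ : ∀ a → imb glue (a ↑ˡ q) ≡ imb T₁ a + ∑[ b < q ] σ (f a b)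
  imb-glue-ˡ a = trans (sum-↑ p _) (cong₂ _+_
    (sum-cong-≗ λ a′ → cong₂ _-_ (cong ⟦_⟧ (arcs-ˡˡ a a′)) (cong ⟦_⟧ (arcs-ˡˡ a′ a)))
    (sum-cong-≗ λ b → trans (cong₂ _-_ (cong ⟦_⟧ (arcs-ˡʳ a b)) (cong ⟦_⟧ (arcs-ʳˡ a b)))
                            (⟦⟧-⟦not⟧ (f a b))))

  imb-glue-ʳ : ∀ b → imb glue (p ↑ʳ b) ≡ - ∑[ a < p ] σ (f a b) + imb T₂ b
  imb-glue-ʳ b = trans (sum-↑ p _) (cong₂ _+_
    (trans (sum-cong-≗ λ a → trans (cong₂ _-_ (cong ⟦_⟧ (arcs-ʳˡ a b)) (cong ⟦_⟧ (arcs-ˡʳ a b)))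
                                   (⟦not⟧-⟦⟧ (f a b)))
           (sum-neg (λ a → σ (f a b))))
    (sum-cong-≗ λ b′ → cong₂ _-_ (cong ⟦_⟧ (arcs-ʳʳ b b′)) (cong ⟦_⟧ (arcs-ʳʳ b′ b))))

open Glue public using (glue; imb-glue-ˡ; imb-glue-ʳ)

module _ {p q} (T₁ : Tournament p) (T₂ : Tournament q) (g : Fin p → Bool) (h : Fin q → Bool) where

  imb-agree-ˡ : ∀ a →
    imb (glue T₁ T₂ (λ a b → g a ≡ᵇ h b)) (a ↑ˡ q) ≡ imb T₁ a + σ (g a) * weight h
  imb-agree-ˡ a = trans (imb-glue-ˡ T₁ T₂ _ a) (cong (_+_ (imb T₁ a))
    (trans (sum-cong-≗ λ b → σ-≡ᵇ (g a) (h b)) (sym (*-distribˡ-sum (σ (g a)) (σ ∘ h)))))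

  imb-agree-ʳ : ∀ b →
    imb (glue T₁ T₂ (λ a b → g a ≡ᵇ h b)) (p ↑ʳ b) ≡ - (σ (h b) * weight g) + imb T₂ b
  imb-agree-ʳ b = trans (imb-glue-ʳ T₁ T₂ _ b) (cong (λ x → - x + imb T₂ b)
    (trans (sum-cong-≗ λ a → trans (σ-≡ᵇ (g a) (h b)) (ℤ.*-comm (σ (g a)) (σ (h b))))
           (sym (*-distribˡ-sum (σ (h b)) (σ ∘ g)))))

reverse : ∀ {k} → Tournament k → Tournament k
reverse T = record
  { arc = λ i j → arc T j i
  ; irrefl = irrefl T
  ; orient = λ i j i≢j → orient T j i (i≢j ∘ sym)
  }

imb-reverse : ∀ {k} (T : Tournament k) v → imb (reverse T) v ≡ - imb T v
imb-reverse {k} T v = trans (sum-cong-≗ λ w → flip-sub ⟦ arc T v w ⟧ ⟦ arc T w v ⟧)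
                             (sum-neg {k} (λ w → ⟦ arc T v w ⟧ - ⟦ arc T w v ⟧))
  where
  flip-sub : ∀ a b → b - a ≡ - (a - b)
  flip-sub = solve-∀

empty : Tournament 0
empty = record { arc = λ () ; irrefl = λ () ; orient = λ () }

tournament⁻ : ∀ {m} → Tournament (suc m) → Tournament m
tournament⁻ R = record
  { arc = λ i j → arc R (suc i) (suc j)
  ; irrefl = irrefl R ∘ suc
  ; orient = λ i j i≢j → orient R (suc i) (suc j) (i≢j ∘ Finₚ.suc-injective)
  }

imb-zero : ∀ {m} (R : Tournament (suc m)) → imb R zero ≡ ∑[ j < m ] σ (arc R zero (suc j))
imb-zero R = trans (cong₂ _+_ (ℤ.+-inverseʳ ⟦ arc R zero zero ⟧)
  (sum-cong-≗ λ j → trans (cong (λ x → ⟦ arc R zero (suc j) ⟧ - ⟦ x ⟧) (orient R zero (suc j) (λ ())))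
                          (⟦⟧-⟦not⟧ (arc R zero (suc j)))))
  (ℤ.+-identityˡ _)

imb-suc : ∀ {m} (R : Tournament (suc m)) j →
  imb R (suc j) ≡ - σ (arc R zero (suc j)) + imb (tournament⁻ R) j
imb-suc R j = cong (_+ imb (tournament⁻ R) j)
  (trans (cong (λ x → ⟦ x ⟧ - ⟦ arc R zero (suc j) ⟧) (orient R zero (suc j) (λ ())))
         (⟦not⟧-⟦⟧ (arc R zero (suc j))))

-- blowup R consists of one copy of B for each vertex of R. Inside a copy the arcs are those of B;
-- between two copies, vertices of the same type follow the arc of R between the copies, and
-- otherwise the vertex of type true wins.
module Blowup {k} (B : Tournament k) (τ : Fin k → Bool) where

  cross : Bool → Fin k → Fin k → Bool
  cross c a b = if τ a ≡ᵇ τ b then c else τ a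

  crossArcs : ∀ {m} → Tournament (suc m) → Fin k → Fin (m ℕ.* k) → Bool
  crossArcs {m} R a v = cross (arc R zero (suc (quotient {m} k v))) a (remainder {m} k v)

  crossArcs-combine : ∀ {m} (R : Tournament (suc m)) a j b →
    crossArcs R a (combine j b) ≡ cross (arc R zero (suc j)) a b
  crossArcs-combine {m} R a j b =
    cong (λ p → cross (arc R zero (suc (proj₁ p))) a (proj₂ p)) (Finₚ.remQuot-combine {m} {k} j b)

  blowup : ∀ {m} → Tournament m → Tournament (m ℕ.* k)
  blowup {zero} R = empty
  blowup {suc m} R = glue B (blowup (tournament⁻ R)) (crossArcs R)

  same diff : Fin k → ℤ
  same a = ∑[ b < k ] ⟦ τ a ≡ᵇ τ b ⟧
  diff a = ∑[ b < k ] ⟦ not (τ a ≡ᵇ τ b) ⟧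

  sum-cross-row : ∀ c a → ∑[ b < k ] σ (cross c a b) ≡ same a * σ c + diff a * σ (τ a)
  sum-cross-row c a = begin
    ∑[ b < k ] σ (cross c a b)
      ≡⟨ sum-cong-≗ split ⟩
    ∑[ b < k ] (⟦ τ a ≡ᵇ τ b ⟧ * σ c + ⟦ not (τ a ≡ᵇ τ b) ⟧ * σ (τ a))
      ≡⟨ sum-+ {k} (λ b → ⟦ τ a ≡ᵇ τ b ⟧ * σ c) (λ b → ⟦ not (τ a ≡ᵇ τ b) ⟧ * σ (τ a)) ⟩
    ∑[ b < k ] (⟦ τ a ≡ᵇ τ b ⟧ * σ c) + ∑[ b < k ] (⟦ not (τ a ≡ᵇ τ b) ⟧ * σ (τ a))
      ≡⟨ sym (cong₂ _+_ (*-distribʳ-sum {k} (σ c) (λ b → ⟦ τ a ≡ᵇ τ b ⟧))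
                       (*-distribʳ-sum {k} (σ (τ a)) (λ b → ⟦ not (τ a ≡ᵇ τ b) ⟧))) ⟩
    same a * σ c + diff a * σ (τ a) ∎
    where
    open ≡-Reasoning
    split : ∀ b → σ (cross c a b) ≡ ⟦ τ a ≡ᵇ τ b ⟧ * σ c + ⟦ not (τ a ≡ᵇ τ b) ⟧ * σ (τ a)
    split b with τ a ≡ᵇ τ b
    ... | true = first (σ c) (σ (τ a))
      where first : ∀ x y → x ≡ + 1 * x + + 0 * y
            first = solve-∀
    ... | false = second (σ c) (σ (τ a))
      where second : ∀ x y → y ≡ + 0 * x + + 1 * y
            second = solve-∀

  sum-cross-column : ∀ c b → ∑[ a < k ] σ (cross c a b) ≡ same b * σ c - diff b * σ (τ b)
  sum-cross-column c b = begin
    ∑[ a < k ] σ (cross c a b)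
      ≡⟨ sum-cong-≗ split ⟩
    ∑[ a < k ] (⟦ τ b ≡ᵇ τ a ⟧ * σ c - ⟦ not (τ b ≡ᵇ τ a) ⟧ * σ (τ b))
      ≡⟨ sum-sub {k} (λ a → ⟦ τ b ≡ᵇ τ a ⟧ * σ c) (λ a → ⟦ not (τ b ≡ᵇ τ a) ⟧ * σ (τ b)) ⟩
    ∑[ a < k ] (⟦ τ b ≡ᵇ τ a ⟧ * σ c) - ∑[ a < k ] (⟦ not (τ b ≡ᵇ τ a) ⟧ * σ (τ b))
      ≡⟨ sym (cong₂ _-_ (*-distribʳ-sum {k} (σ c) (λ a → ⟦ τ b ≡ᵇ τ a ⟧))
                       (*-distribʳ-sum {k} (σ (τ b)) (λ a → ⟦ not (τ b ≡ᵇ τ a) ⟧))) ⟩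
    same b * σ c - diff b * σ (τ b) ∎
    where
    open ≡-Reasoning
    same-type : ∀ x y → x ≡ + 1 * x - + 0 * y
    same-type = solve-∀
    split : ∀ a → σ (cross c a b) ≡ ⟦ τ b ≡ᵇ τ a ⟧ * σ c - ⟦ not (τ b ≡ᵇ τ a) ⟧ * σ (τ b)
    split a with τ a | τ b
    ... | true | true = same-type (σ c) (+ 1)
    ... | false | false = same-type (σ c) (- + 1)
    ... | true | false = refl
    ... | false | true = refl

  imb-blowup : ∀ {m} (R : Tournament (suc m)) j a →
    imb (blowup R) (combine j a) ≡ imb B a + same a * imb R j + + m * (diff a * σ (τ a))
  imb-blowup {m} R zero a = begin
    imb (blowup R) (a ↑ˡ m ℕ.* k)
      ≡⟨ imb-glue-ˡ B (blowup (tournament⁻ R)) _ a ⟩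
    imb B a + ∑[ v < m ℕ.* k ] σ (crossArcs R a v)
      ≡⟨ cong (_+_ (imb B a)) (sum-combine {m} {k} (σ ∘ crossArcs R a)) ⟩
    imb B a + ∑[ j < m ] ∑[ b < k ] σ (crossArcs R a (combine j b))
      ≡⟨ cong (_+_ (imb B a)) (sum-cong-≗ λ j → trans (sum-cong-≗ λ b → cong σ (crossArcs-combine R a j b))
                                                      (sum-cross-row (arc R zero (suc j)) a)) ⟩
    imb B a + ∑[ j < m ] (same a * σ (arc R zero (suc j)) + diff a * σ (τ a))
      ≡⟨ cong (_+_ (imb B a)) (trans (sum-+ {m} (λ j → same a * σ (arc R zero (suc j))) (λ _ → diff a * σ (τ a)))
           (cong₂ _+_ (trans (sym (*-distribˡ-sum {m} (same a) (λ j → σ (arc R zero (suc j)))))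
                             (cong (same a *_) (sym (imb-zero R))))
                      (sum-const m (diff a * σ (τ a))))) ⟩
    imb B a + (same a * imb R zero + + m * (diff a * σ (τ a)))
      ≡⟨ sym (ℤ.+-assoc (imb B a) _ _) ⟩
    imb B a + same a * imb R zero + + m * (diff a * σ (τ a)) ∎
    where open ≡-Reasoning
  imb-blowup {suc m} R (suc j) b = begin
    imb (blowup R) (k ↑ʳ combine j b)
      ≡⟨ imb-glue-ʳ B (blowup (tournament⁻ R)) _ (combine j b) ⟩
    - ∑[ a < k ] σ (crossArcs R a (combine j b)) + imb (blowup (tournament⁻ R)) (combine j b)
      ≡⟨ cong₂ (λ x y → - x + y)
           (trans (sum-cong-≗ λ a → cong σ (crossArcs-combine R a j b)) (sum-cross-column c b))
           (imb-blowup (tournament⁻ R) j b) ⟩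
    - (same b * σ c - diff b * σ (τ b))
      + (imb B b + same b * imb (tournament⁻ R) j + + m * (diff b * σ (τ b)))
      ≡⟨ regroup (same b) (σ c) (diff b) (σ (τ b)) (imb B b) (imb (tournament⁻ R) j) (+ m) ⟩
    imb B b + same b * (- σ c + imb (tournament⁻ R) j) + (+ 1 + + m) * (diff b * σ (τ b))
      ≡⟨ cong (λ x → imb B b + same b * x + + suc m * (diff b * σ (τ b))) (sym (imb-suc R j)) ⟩
    imb B b + same b * imb R (suc j) + + suc m * (diff b * σ (τ b)) ∎
    where
    open ≡-Reasoning
    c = arc R zero (suc j)
    regroup : ∀ S x D y I r m →
      - (S * x - D * y) + (I + S * r + m * (D * y)) ≡ I + S * (- x + r) + (+ 1 + m) * (D * y)
    regroup = solve-∀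

-- Regular and near-regular tournaments

singleton : Tournament 1
singleton = record
  { arc = λ _ _ → false ; irrefl = λ _ → refl ; orient = λ { zero zero 0≢0 → ⊥-elim (0≢0 refl) } }

arrow : Tournament 2
arrow = record { arc = forward ; irrefl = λ { zero → refl ; (suc zero) → refl } ; orient = opposite }
  where
  forward : Fin 2 → Fin 2 → Bool
  forward zero (suc zero) = true
  forward _ _ = false
  opposite : ∀ i j → i ≢ j → forward j i ≡ not (forward i j)
  opposite zero zero 0≢0 = ⊥-elim (0≢0 refl)
  opposite zero (suc zero) _ = refl
  opposite (suc zero) zero _ = refl
  opposite (suc zero) (suc zero) 1≢1 = ⊥-elim (1≢1 refl)

arrowLabel : Fin 2 → Bool
arrowLabel zero = false
arrowLabel (suc zero) = true

imb-arrow : ∀ i → imb arrow i ≡ - σ (arrowLabel i)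
imb-arrow zero = refl
imb-arrow (suc zero) = refl

regularLabel : ∀ r → Fin (suc (r ℕ.* 2)) → Bool
regularLabel zero _ = true
regularLabel (suc r) = arrowLabel ++ regularLabel r

regular : ∀ r → Tournament (suc (r ℕ.* 2))
regular zero = singleton
regular (suc r) = glue arrow (regular r) (λ a b → arrowLabel a ≡ᵇ regularLabel r b)

weight-regularLabel : ∀ r → weight (regularLabel r) ≡ + 1
weight-regularLabel zero = refl
weight-regularLabel (suc r) =
  trans (weight-++ arrowLabel (regularLabel r)) (cong (_+_ (+ 0)) (weight-regularLabel r))

imb-regular : ∀ r v → imb (regular r) v ≡ + 0
imb-regular zero zero = refl
imb-regular (suc r) = ↑-elim 2 arrowSide regularSide
  where
  arrowSide : ∀ a → imb (regular (suc r)) (a ↑ˡ suc (r ℕ.* 2)) ≡ + 0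
  arrowSide a = trans (imb-agree-ˡ arrow (regular r) arrowLabel (regularLabel r) a)
    (trans (cong₂ (λ x y → x + σ (arrowLabel a) * y) (imb-arrow a) (weight-regularLabel r))
           (balanced (arrowLabel a)))
    where
    balanced : ∀ b → - σ b + σ b * + 1 ≡ + 0
    balanced true = refl
    balanced false = refl
  regularSide : ∀ b → imb (regular (suc r)) (2 ↑ʳ b) ≡ + 0
  regularSide b = trans (imb-agree-ʳ arrow (regular r) arrowLabel (regularLabel r) b)
    (trans (cong₂ (λ x y → - x + y) (ℤ.*-zeroʳ (σ (regularLabel r b))) (imb-regular r b)) refl)

nearRegularLabel : ∀ s → Fin (s ℕ.* 2) → Bool
nearRegularLabel zero ()
nearRegularLabel (suc s) = arrowLabel ++ nearRegularLabel s

nearRegular : ∀ s → Tournament (s ℕ.* 2)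
nearRegular zero = empty
nearRegular (suc s) = glue arrow (nearRegular s) (λ a b → arrowLabel a ≡ᵇ nearRegularLabel s b)

weight-nearRegularLabel : ∀ s → weight (nearRegularLabel s) ≡ + 0
weight-nearRegularLabel zero = refl
weight-nearRegularLabel (suc s) =
  trans (weight-++ arrowLabel (nearRegularLabel s)) (cong (_+_ (+ 0)) (weight-nearRegularLabel s))

imb-nearRegular : ∀ s v → imb (nearRegular s) v ≡ - σ (nearRegularLabel s v)
imb-nearRegular (suc s) = ↑-elim 2 arrowSide nearRegularSide
  where
  arrowSide : ∀ a →
    imb (nearRegular (suc s)) (a ↑ˡ s ℕ.* 2) ≡ - σ (nearRegularLabel (suc s) (a ↑ˡ s ℕ.* 2))
  arrowSide a = trans (imb-agree-ˡ arrow (nearRegular s) arrowLabel (nearRegularLabel s) a)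
    (trans (cong₂ (λ x y → x + σ (arrowLabel a) * y) (imb-arrow a) (weight-nearRegularLabel s))
      (trans (cong (_+_ (- σ (arrowLabel a))) (ℤ.*-zeroʳ (σ (arrowLabel a))))
        (trans (ℤ.+-identityʳ _) (cong (-_ ∘ σ) (sym (lookup-++ˡ arrowLabel (nearRegularLabel s) a))))))
  nearRegularSide : ∀ b → imb (nearRegular (suc s)) (2 ↑ʳ b) ≡ - σ (nearRegularLabel s b)
  nearRegularSide b = trans (imb-agree-ʳ arrow (nearRegular s) arrowLabel (nearRegularLabel s) b)
    (trans (cong₂ (λ x y → - x + y) (ℤ.*-zeroʳ (σ (nearRegularLabel s b))) (imb-nearRegular s b))
           (ℤ.+-identityˡ _))

imb-++ : ∀ {p q} s (T : Tournament (p ℕ.+ q)) (t₁ : Vector ℤ p) (t₂ : Vector ℤ q)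
  (g₁ : Vector Bool p) (g₂ : Vector Bool q) →
  (∀ a → imb T (a ↑ˡ q) ≡ t₁ a + s * σ (g₁ a)) → (∀ b → imb T (p ↑ʳ b) ≡ t₂ b + s * σ (g₂ b)) →
  ∀ v → imb T v ≡ (t₁ ++ t₂) v + s * σ ((g₁ ++ g₂) v)
imb-++ {p} {q} s T t₁ t₂ g₁ g₂ left right = ↑-elim p
  (λ a → trans (left a) (sym (cong₂ (λ t l → t + s * σ l) (lookup-++ˡ t₁ t₂ a) (lookup-++ˡ g₁ g₂ a))))
  (λ b → trans (right b) (sym (cong₂ (λ t l → t + s * σ l) (lookup-++ʳ t₁ t₂ b) (lookup-++ʳ g₁ g₂ b))))

-- In D ⊕ E a vertex of D beats exactly
-- the vertices of E carrying the same label; this adds σ (label v) · w to the imbalances in D and,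
-- as D has label weight 0, leaves those in E unchanged.
record Design (s w : ℤ) : Set where
  field
    order        : ℕ
    tournament   : Tournament order
    label        : Fin order → Bool
    target       : Fin order → ℤ
    weight-label : weight label ≡ w
    imb-target   : ∀ v → imb tournament v ≡ target v + s * σ (label v)
open Design public

Attains : ∀ {s w} → Design s w → ℤ → Set
Attains D t = ∃ λ v → target D v ≡ t

imb≡target : ∀ {w} (D : Design (+ 0) w) v → imb (tournament D) v ≡ target D v
imb≡target D v = trans (imb-target D v) (ℤ.+-identityʳ (target D v))

∅ : ∀ {s} → Design s (+ 0)
∅ = record
  { order = 0 ; tournament = empty ; label = λ () ; target = λ ()
  ; weight-label = refl ; imb-target = λ () }

_⊕_ : ∀ {s w} → Design s (+ 0) → Design (s + w) w → Design (s + w) w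
_⊕_ {s} {w} D E = record
  { order = order D ℕ.+ order E
  ; tournament = G
  ; label = label D ++ label E
  ; target = target D ++ target E
  ; weight-label = trans (weight-++ (label D) (label E))
      (trans (cong₂ _+_ (weight-label D) (weight-label E)) (ℤ.+-identityˡ w))
  ; imb-target = imb-++ (s + w) G (target D) (target E) (label D) (label E) left right
  }
  where
  open ≡-Reasoning
  G = glue (tournament D) (tournament E) (λ a b → label D a ≡ᵇ label E b)
  left : ∀ a → imb G (a ↑ˡ order E) ≡ target D a + (s + w) * σ (label D a)
  left a = begin
    imb G (a ↑ˡ order E)
      ≡⟨ imb-agree-ˡ (tournament D) (tournament E) (label D) (label E) a ⟩
    imb (tournament D) a + σ (label D a) * weight (label E)
      ≡⟨ cong₂ (λ x y → x + σ (label D a) * y) (imb-target D a) (weight-label E) ⟩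
    target D a + s * σ (label D a) + σ (label D a) * w
      ≡⟨ regroup (target D a) s (σ (label D a)) w ⟩
    target D a + (s + w) * σ (label D a) ∎
    where
    regroup : ∀ t s x w → t + s * x + x * w ≡ t + (s + w) * x
    regroup = solve-∀
  right : ∀ b → imb G (order D ↑ʳ b) ≡ target E b + (s + w) * σ (label E b)
  right b = begin
    imb G (order D ↑ʳ b)
      ≡⟨ imb-agree-ʳ (tournament D) (tournament E) (label D) (label E) b ⟩
    - (σ (label E b) * weight (label D)) + imb (tournament E) b
      ≡⟨ cong₂ (λ x y → - (σ (label E b) * x) + y) (weight-label D) (imb-target E b) ⟩
    - (σ (label E b) * + 0) + (target E b + (s + w) * σ (label E b))
      ≡⟨ vanish (σ (label E b)) _ ⟩
    target E b + (s + w) * σ (label E b) ∎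
    where
    vanish : ∀ x y → - (x * + 0) + y ≡ y
    vanish = solve-∀

bipartite : ∀ {s w₁ w₂} → Design s w₁ → Design s w₂ → Design s (w₁ + w₂)
bipartite {s} D E = record
  { order = p ℕ.+ q
  ; tournament = G
  ; label = label D ++ label E
  ; target = (λ a → target D a + + q) ++ (λ b → target E b - + p)
  ; weight-label = trans (weight-++ (label D) (label E)) (cong₂ _+_ (weight-label D) (weight-label E))
  ; imb-target = imb-++ s G _ _ (label D) (label E) left right
  }
  where
  p = order D
  q = order E
  G = glue (tournament D) (tournament E) (λ _ _ → true)
  wins : ∀ n → ∑[ i < n ] σ true ≡ + n
  wins n = trans (sum-const n (+ 1)) (ℤ.*-identityʳ (+ n))
  left : ∀ a → imb G (a ↑ˡ q) ≡ target D a + + q + s * σ (label D a)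
  left a = trans (imb-glue-ˡ (tournament D) (tournament E) _ a)
    (trans (cong₂ _+_ (imb-target D a) (wins q)) (swap (target D a) _ (+ q)))
    where
    swap : ∀ t x q → t + x + q ≡ t + q + x
    swap = solve-∀
  right : ∀ b → imb G (p ↑ʳ b) ≡ target E b - + p + s * σ (label E b)
  right b = trans (imb-glue-ʳ (tournament D) (tournament E) _ b)
    (trans (cong₂ (λ x y → - x + y) (wins p) (imb-target E b)) (swap (+ p) (target E b) _))
    where
    swap : ∀ p t x → - p + (t + x) ≡ t - p + x
    swap = solve-∀

reverseᴰ : ∀ {s w} → Design s w → Design (- s) w
reverseᴰ {s} D = record
  { order = order D
  ; tournament = reverse (tournament D)
  ; label = label D
  ; target = -_ ∘ target D
  ; weight-label = weight-label D
  ; imb-target = λ v → trans (imb-reverse (tournament D) v)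
      (trans (cong -_ (imb-target D v)) (negate (target D v) s (σ (label D v))))
  }
  where
  negate : ∀ t s x → - (t + s * x) ≡ - t + - s * x
  negate = solve-∀

flipLabels : ∀ {w} → Design (+ 0) w → Design (+ 0) (- w)
flipLabels D = record
  { order = order D
  ; tournament = tournament D
  ; label = not ∘ label D
  ; target = target D
  ; weight-label = trans (sum-cong-≗ (σ-not ∘ label D))
      (trans (sum-neg (σ ∘ label D)) (cong -_ (weight-label D)))
  ; imb-target = imb-target D
  }

regularᴰ : ℕ → Design (+ 0) (+ 1)
regularᴰ r = record
  { order = suc (r ℕ.* 2)
  ; tournament = regular r
  ; label = regularLabel r
  ; target = λ _ → + 0
  ; weight-label = weight-regularLabel r
  ; imb-target = imb-regular r
  }

nearRegularᴰ : ℕ → Design (- + 1) (+ 0)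
nearRegularᴰ s = record
  { order = s ℕ.* 2
  ; tournament = nearRegular s
  ; label = nearRegularLabel s
  ; target = λ _ → + 0
  ; weight-label = weight-nearRegularLabel s
  ; imb-target = λ v → trans (imb-nearRegular s v) (-σ≡ (nearRegularLabel s v))
  }
  where
  -σ≡ : ∀ b → - σ b ≡ + 0 + - + 1 * σ b
  -σ≡ true = refl
  -σ≡ false = refl

foldr-⊕ : ∀ {s w} → (ℤ × ℤ → Design s (+ 0)) → List (ℤ × ℤ) → Design (s + w) w → Design (s + w) w
foldr-⊕ G P E = foldr (λ pr D → G pr ⊕ D) E P

module _ {s w} (G : ℤ × ℤ → Design s (+ 0)) (E : Design (s + w) w) where

  order-foldr-⊕ : ∀ P → + order (foldr-⊕ G P E) ≡ sumℤ (map (λ pr → + order (G pr)) P) + + order E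
  order-foldr-⊕ [] = sym (ℤ.+-identityˡ _)
  order-foldr-⊕ (pr ∷ P) = trans (ℤ.pos-+ (order (G pr)) _)
    (trans (cong (_+_ (+ order (G pr))) (order-foldr-⊕ P))
           (sym (ℤ.+-assoc (+ order (G pr)) (sumℤ (map (λ pr → + order (G pr)) P)) (+ order E))))

  foldr-⊕-targets : ∀ P v →
    (∃ λ pr → pr ∈ P × Attains (G pr) (target (foldr-⊕ G P E) v)) ⊎ Attains E (target (foldr-⊕ G P E) v)
  foldr-⊕-targets [] v = inj₂ (v , refl)
  foldr-⊕-targets (pr ∷ P) v with ++-values (target (G pr)) (target (foldr-⊕ G P E)) v
  ... | inj₁ (a , e) = inj₁ (pr , here refl , a , e)
  ... | inj₂ (b , e) with foldr-⊕-targets P b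
  ...   | inj₁ (pr′ , pr′∈P , a , e′) = inj₁ (pr′ , there pr′∈P , a , trans e′ e)
  ...   | inj₂ (c , e′) = inj₂ (c , trans e′ e)

  foldr-⊕-attainsᴳ : ∀ {P pr t} → pr ∈ P → Attains (G pr) t → Attains (foldr-⊕ G P E) t
  foldr-⊕-attainsᴳ {pr ∷ P} (here refl) (a , e) =
    a ↑ˡ _ , trans (lookup-++ˡ (target (G pr)) (target (foldr-⊕ G P E)) a) e
  foldr-⊕-attainsᴳ {pr′ ∷ P} (there pr∈P) att with foldr-⊕-attainsᴳ pr∈P att
  ... | b , e = order (G pr′) ↑ʳ b , trans (lookup-++ʳ (target (G pr′)) (target (foldr-⊕ G P E)) b) e

  foldr-⊕-attainsᴱ : ∀ {P t} → Attains E t → Attains (foldr-⊕ G P E) t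
  foldr-⊕-attainsᴱ {[]} att = att
  foldr-⊕-attainsᴱ {pr ∷ P} att with foldr-⊕-attainsᴱ {P} att
  ... | b , e = order (G pr) ↑ʳ b , trans (lookup-++ʳ (target (G pr)) (target (foldr-⊕ G P E)) b) e

module _ {s w₁ w₂} (D : Design s w₁) (E : Design s w₂)
         (D≡0 : ∀ a → target D a ≡ + 0) (E≡0 : ∀ b → target E b ≡ + 0) where

  private
    tˡ : Vector ℤ (order D)
    tˡ a = target D a + + order E
    tʳ : Vector ℤ (order E)
    tʳ b = target E b - + order D

  bipartite-targets : ∀ v → target (bipartite D E) v ≡ + order E ⊎ target (bipartite D E) v ≡ - + order D
  bipartite-targets = ↑-elim (order D)
    (λ a → inj₁ (trans (lookup-++ˡ tˡ tʳ a) (cong (_+ + order E) (D≡0 a))))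
    (λ b → inj₂ (trans (lookup-++ʳ tˡ tʳ b) (trans (cong (_- + order D) (E≡0 b)) (ℤ.+-identityˡ _))))

  bipartite-attainsˡ : Fin (order D) → Attains (bipartite D E) (+ order E)
  bipartite-attainsˡ a = a ↑ˡ order E , trans (lookup-++ˡ tˡ tʳ a) (cong (_+ + order E) (D≡0 a))

  bipartite-attainsʳ : Fin (order E) → Attains (bipartite D E) (- + order D)
  bipartite-attainsʳ b = order D ↑ʳ b ,
    trans (lookup-++ʳ tˡ tʳ b) (trans (cong (_- + order D) (E≡0 b)) (ℤ.+-identityˡ _))

record TwoValued (x y : ℤ) : Set where
  field
    design    : Design (+ 0) (+ 1)
    targets   : ∀ v → target design v ≡ x ⊎ target design v ≡ y
    attains-x : Attains design x
    attains-y : Attains design y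
    order<    : + order design < + 2 * (x - y)

module TwoValuedBlowup (d w c : ℕ) where

  block : Design (+ 0) (+ 1)
  block = nearRegularᴰ c ⊕ regularᴰ w

  k : ℕ
  k = c ℕ.* 2 ℕ.+ suc (w ℕ.* 2)

  inRegular : Fin k → Bool
  inRegular = _++_ {m = c ℕ.* 2} (λ _ → false) (λ _ → true)

  open Blowup (tournament block) inRegular

  value : Bool → ℤ
  value true = + (d ℕ.* 2 ℕ.* (c ℕ.* 2))
  value false = - + (d ℕ.* 2 ℕ.* suc (w ℕ.* 2))

  imb-block : ∀ a → imb (tournament block) a ≡ + 0
  imb-block a with ++-values {p = c ℕ.* 2} (λ _ → + 0) (λ _ → + 0) a
  ... | inj₁ (_ , e) = trans (imb≡target block a) (sym e)
  ... | inj₂ (_ , e) = trans (imb≡target block a) (sym e)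

  count-opposite : ∀ x →
    ∑[ b < k ] ⟦ not (x ≡ᵇ inRegular b) ⟧ ≡ (if x then + (c ℕ.* 2) else + suc (w ℕ.* 2))
  count-opposite x = trans (sum-++ {p = c ℕ.* 2} (λ y → ⟦ not (x ≡ᵇ y) ⟧) (λ _ → false) (λ _ → true))
    (trans (cong₂ _+_ (sum-const (c ℕ.* 2) ⟦ not (x ≡ᵇ false) ⟧) (sum-const (suc (w ℕ.* 2)) ⟦ not (x ≡ᵇ true) ⟧))
           (count x))
    where
    count : ∀ x → + (c ℕ.* 2) * ⟦ not (x ≡ᵇ false) ⟧ + + suc (w ℕ.* 2) * ⟦ not (x ≡ᵇ true) ⟧
                  ≡ (if x then + (c ℕ.* 2) else + suc (w ℕ.* 2))
    count true =
      trans (cong₂ _+_ (ℤ.*-identityʳ (+ (c ℕ.* 2))) (ℤ.*-zeroʳ (+ suc (w ℕ.* 2)))) (ℤ.+-identityʳ _)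
    count false =
      trans (cong₂ _+_ (ℤ.*-zeroʳ (+ (c ℕ.* 2))) (ℤ.*-identityʳ (+ suc (w ℕ.* 2)))) (ℤ.+-identityˡ _)

  scaled-value : ∀ x → + (d ℕ.* 2) * ((if x then + (c ℕ.* 2) else + suc (w ℕ.* 2)) * σ x) ≡ value x
  scaled-value true = trans (cong (+ (d ℕ.* 2) *_) (ℤ.*-identityʳ _)) (sym (ℤ.pos-* (d ℕ.* 2) (c ℕ.* 2)))
  scaled-value false = trans (negate (+ (d ℕ.* 2)) (+ suc (w ℕ.* 2))) (cong -_ (sym (ℤ.pos-* (d ℕ.* 2) _)))
    where
    negate : ∀ a b → a * (b * - + 1) ≡ - (a * b)
    negate = solve-∀

  imb-blowup-regular : ∀ j a → imb (blowup (regular d)) (combine j a) ≡ value (inRegular a)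
  imb-blowup-regular j a = begin
    imb (blowup (regular d)) (combine j a)
      ≡⟨ imb-blowup (regular d) j a ⟩
    imb (tournament block) a + same a * imb (regular d) j + + (d ℕ.* 2) * (diff a * σ (inRegular a))
      ≡⟨ cong₂ (λ x y → x + same a * y + + (d ℕ.* 2) * (diff a * σ (inRegular a)))
               (imb-block a) (imb-regular d j) ⟩
    + 0 + same a * + 0 + + (d ℕ.* 2) * (diff a * σ (inRegular a))
      ≡⟨ vanish (same a) _ ⟩
    + (d ℕ.* 2) * (diff a * σ (inRegular a))
      ≡⟨ cong (λ n → + (d ℕ.* 2) * (n * σ (inRegular a))) (count-opposite (inRegular a)) ⟩
    + (d ℕ.* 2) * ((if inRegular a then + (c ℕ.* 2) else + suc (w ℕ.* 2)) * σ (inRegular a))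
      ≡⟨ scaled-value (inRegular a) ⟩
    value (inRegular a) ∎
    where
    open ≡-Reasoning
    vanish : ∀ s x → + 0 + s * + 0 + x ≡ x
    vanish = solve-∀

  design : Design (+ 0) (+ 1)
  design = record
    { order = suc (d ℕ.* 2) ℕ.* k
    ; tournament = blowup (regular d)
    ; label = λ v → regularLabel d (quotient k v) ≡ᵇ label block (remainder {suc (d ℕ.* 2)} k v)
    ; target = λ v → value (inRegular (remainder {suc (d ℕ.* 2)} k v))
    ; weight-label = trans (weight-combine (regularLabel d) (label block))
        (cong₂ _*_ (weight-regularLabel d) (weight-label block))
    ; imb-target = λ v → trans (cong (imb (blowup (regular d))) (sym (Finₚ.combine-remQuot {suc (d ℕ.* 2)} k v)))
        (trans (imb-blowup-regular (quotient k v) (remainder {suc (d ℕ.* 2)} k v)) (sym (ℤ.+-identityʳ _)))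
    }

  value-difference : value true - value false ≡ + (d ℕ.* 2 ℕ.* k)
  value-difference =
    trans (cong (_+_ (+ (d ℕ.* 2 ℕ.* (c ℕ.* 2)))) (ℤ.neg-involutive (+ (d ℕ.* 2 ℕ.* suc (w ℕ.* 2)))))
    (trans (sym (ℤ.pos-+ (d ℕ.* 2 ℕ.* (c ℕ.* 2)) (d ℕ.* 2 ℕ.* suc (w ℕ.* 2))))
           (cong +_ (sym (ℕₚ.*-distribˡ-+ (d ℕ.* 2) (c ℕ.* 2) (suc (w ℕ.* 2))))))

  attains-value : ∀ x → (∃ λ a → inRegular a ≡ x) → Attains design (value x)
  attains-value x (a , τa≡x) = combine {suc (d ℕ.* 2)} zero a ,
    trans (cong (value ∘ inRegular ∘ proj₂) (Finₚ.remQuot-combine {suc (d ℕ.* 2)} zero a)) (cong value τa≡x)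

  targets-value : ∀ v → target design v ≡ value true ⊎ target design v ≡ value false
  targets-value v with inRegular (remainder {suc (d ℕ.* 2)} k v)
  ... | true = inj₁ refl
  ... | false = inj₂ refl

blowup-order< : ∀ d k → 0 ℕ.< k → suc (suc d ℕ.* 2) ℕ.* k ℕ.< 2 ℕ.* (suc d ℕ.* 2 ℕ.* k)
blowup-order< d k 0<k = subst (suc (suc d ℕ.* 2) ℕ.* k ℕ.<_) (sym (split d k))
  (ℕₚ.m<m+n _ (ℕₚ.<-≤-trans 0<k (ℕₚ.m≤m+n k (d ℕ.* 2 ℕ.* k))))
  where
  split : ∀ d k → 2 ℕ.* (suc d ℕ.* 2 ℕ.* k) ≡ suc (suc d ℕ.* 2) ℕ.* k ℕ.+ (k ℕ.+ d ℕ.* 2 ℕ.* k)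
  split = ℕ-Solver.solve-∀

twoValued : ∀ d w c → TwoValued (+ (suc d ℕ.* 2 ℕ.* (suc c ℕ.* 2))) (- + (suc d ℕ.* 2 ℕ.* suc (w ℕ.* 2)))
twoValued d w c = record
  { design = design
  ; targets = targets-value
  ; attains-x = attains-value true
      (suc c ℕ.* 2 ↑ʳ zero , lookup-++ʳ {m = suc c ℕ.* 2} (λ _ → false) (λ _ → true) zero)
  ; attains-y = attains-value false (zero , refl)
  ; order< = subst (λ n → + order design < + 2 * n) (sym value-difference)
      (subst (+ order design <_) (sym (ℤ.pos-* 2 (suc d ℕ.* 2 ℕ.* k)))
        (+<+ (blowup-order< d k (ℕₚ.<-≤-trans (ℕₚ.0<1+n) (ℕₚ.m≤n+m (suc (w ℕ.* 2)) (suc c ℕ.* 2))))))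
  }
  where open TwoValuedBlowup (suc d) w (suc c)

TwoValued-swap : ∀ {x y} → TwoValued x y → TwoValued (- y) (- x)
TwoValued-swap {x} {y} V = record
  { design = reverseᴰ design
  ; targets = λ v → Sum.swap (Sum.map (cong (λ t → - t)) (cong (λ t → - t)) (targets v))
  ; attains-x = map₂ (cong (λ t → - t)) attains-y
  ; attains-y = map₂ (cong (λ t → - t)) attains-x
  ; order< = subst (λ n → + order design < + 2 * n) (swap-sub x y) order<
  }
  where
  open TwoValued V
  swap-sub : ∀ x y → x - y ≡ - y - - x
  swap-sub = solve-∀

-- Parity and 2-adic valuations

parity : ∀ n → n ≡ ⌊ n /2⌋ ℕ.* 2 ⊎ n ≡ suc (⌊ n /2⌋ ℕ.* 2)
parity zero = inj₁ refl
parity (suc zero) = inj₂ refl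
parity (suc (suc n)) = Sum.map (cong (λ m → suc (suc m))) (cong (λ m → suc (suc m))) (parity n)

even-* : ∀ h → EvenInt (+ (h ℕ.* 2))
even-* h = + h , trans (ℤ.pos-* h 2) (ℤ.*-comm (+ h) (+ 2))

odd-* : ∀ h → OddInt (+ suc (h ℕ.* 2))
odd-* h = + h , cong (_+_ (+ 1)) (proj₂ (even-* h))

even-neg : ∀ {z} → EvenInt z → EvenInt (- z)
even-neg (t , z≡2t) = - t , trans (cong (λ z → - z) z≡2t) (ℤ.neg-distribʳ-* (+ 2) t)

odd-neg : ∀ {z} → OddInt z → OddInt (- z)
odd-neg (t , z≡1+2t) = - t - + 1 , trans (cong (λ z → - z) z≡1+2t) (negate t)
  where
  negate : ∀ t → - (+ 1 + + 2 * t) ≡ + 1 + + 2 * (- t - + 1)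
  negate = solve-∀

even≢odd : ∀ {z} → EvenInt z → OddInt z → ⊥
even≢odd {z} (a , z≡2a) (b , z≡1+2b) =
  2*m≢1 ∣ a - b ∣ (trans (sym (ℤ.abs-* (+ 2) (a - b))) (cong ∣_∣ 2[a-b]≡1))
  where
  open ≡-Reasoning
  2*m≢1 : ∀ m → 2 ℕ.* m ≢ 1
  2*m≢1 zero ()
  2*m≢1 (suc zero) ()
  2*m≢1 (suc (suc m)) ()
  distrib : ∀ a b → + 2 * (a - b) ≡ + 2 * a - + 2 * b
  distrib = solve-∀
  cancel : ∀ b → + 1 + + 2 * b - + 2 * b ≡ + 1
  cancel = solve-∀
  2[a-b]≡1 : + 2 * (a - b) ≡ + 1
  2[a-b]≡1 = begin
    + 2 * (a - b)             ≡⟨ distrib a b ⟩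
    + 2 * a - + 2 * b         ≡⟨ cong (_- + 2 * b) (trans (sym z≡2a) z≡1+2b) ⟩
    + 1 + + 2 * b - + 2 * b   ≡⟨ cancel b ⟩
    + 1                       ∎

odd≢0 : ∀ {z} → OddInt z → z ≢ + 0
odd≢0 odd refl = even≢odd (+ 0 , refl) odd

from-∣∣ : ∀ {P : ℤ → Set} → (∀ {z} → P z → P (- z)) → ∀ z → P (+ ∣ z ∣) → P z
from-∣∣ {P} P-neg z p with ℤ.+∣i∣≡i⊎+∣i∣≡-i z
... | inj₁ ∣z∣≡z = subst P ∣z∣≡z p
... | inj₂ ∣z∣≡-z = subst P (ℤ.neg-involutive z) (P-neg (subst P ∣z∣≡-z p))

odd-∣∣ : ∀ {z} → OddInt z → ∣ z ∣ ≡ suc (⌊ ∣ z ∣ /2⌋ ℕ.* 2)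
odd-∣∣ {z} odd with parity ∣ z ∣
... | inj₂ ∣z∣-odd = ∣z∣-odd
... | inj₁ ∣z∣-even =
  ⊥-elim (even≢odd (from-∣∣ {EvenInt} even-neg z (subst (EvenInt ∘ +_) (sym ∣z∣-even) (even-* ⌊ ∣ z ∣ /2⌋)))
                   odd)

even-∣∣ : ∀ {z} → EvenInt z → ∣ z ∣ ≡ ⌊ ∣ z ∣ /2⌋ ℕ.* 2
even-∣∣ {z} even with parity ∣ z ∣
... | inj₁ ∣z∣-even = ∣z∣-even
... | inj₂ ∣z∣-odd =
  ⊥-elim (even≢odd even
                   (from-∣∣ {OddInt} odd-neg z (subst (OddInt ∘ +_) (sym ∣z∣-odd) (odd-* ⌊ ∣ z ∣ /2⌋))))

<0⇒-+∣∣ : ∀ {z} → z < + 0 → - + ∣ z ∣ ≡ z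
<0⇒-+∣∣ { -[1+ n ]} _ = refl
<0⇒-+∣∣ {+ n} (+<+ ())

sum-odd : ∀ {n} (g : Fin n → ℤ) → (∀ i → OddInt (g i)) → ∃ λ m → sum g ≡ + n + + 2 * m
sum-odd {zero} g odd = + 0 , refl
sum-odd {suc n} g odd with odd zero | sum-odd (g ∘ suc) (odd ∘ suc)
... | t , g0≡1+2t | m , Σ≡n+2m = t + m , trans (cong₂ _+_ g0≡1+2t Σ≡n+2m) (regroup t (+ n) m)
  where
  regroup : ∀ t n m → + 1 + + 2 * t + (n + + 2 * m) ≡ + 1 + n + + 2 * (t + m)
  regroup = solve-∀

record TwoAdic (n : ℕ) : Set where
  field
    valuation oddPart : ℕ
    factorisation : n ≡ 2 ^ valuation ℕ.* suc (oddPart ℕ.* 2)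

twoAdic : ∀ n → TwoAdic (suc n)
twoAdic = <-rec (TwoAdic ∘ suc) step
  where
  step : ∀ n → (∀ {m} → m ℕ.< n → TwoAdic (suc m)) → TwoAdic (suc n)
  step zero _ = record { valuation = 0 ; oddPart = 0 ; factorisation = refl }
  step (suc n) rec with parity n
  ... | inj₂ n≡odd = record
    { valuation = 0
    ; oddPart = suc ⌊ n /2⌋
    ; factorisation = trans (cong (λ m → suc (suc m)) n≡odd) (sym (ℕₚ.*-identityˡ _))
    }
  ... | inj₁ n≡even = record
    { valuation = suc valuation
    ; oddPart = oddPart
    ; factorisation = trans (cong (λ m → suc (suc m)) n≡even)
        (trans (cong (ℕ._* 2) factorisation) (double (2 ^ valuation) (suc (oddPart ℕ.* 2))))
    }
    where
    open TwoAdic (rec (ℕ.s≤s (ℕₚ.⌊n/2⌋≤n n)))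
    double : ∀ a o → a ℕ.* o ℕ.* 2 ≡ 2 ℕ.* a ℕ.* o
    double = ℕ-Solver.solve-∀

-- Opaque, so that unification never unfolds the well-founded recursion behind ν and ω.
opaque
  ν ω : ℤ → ℕ
  ν z = TwoAdic.valuation (twoAdic (ℕ.pred ∣ z ∣))
  ω z = TwoAdic.oddPart (twoAdic (ℕ.pred ∣ z ∣))

  ∣∣-factorisation : ∀ {z} → z ≢ + 0 → ∣ z ∣ ≡ 2 ^ ν z ℕ.* suc (ω z ℕ.* 2)
  ∣∣-factorisation {+ zero} z≢0 = ⊥-elim (z≢0 refl)
  ∣∣-factorisation {+ suc n} _ = TwoAdic.factorisation (twoAdic n)
  ∣∣-factorisation { -[1+ n ]} _ = TwoAdic.factorisation (twoAdic n)

ν-factorisation : ∀ {z} → z ≢ + 0 → ∃ λ g → OddInt g × z ≡ + (2 ^ ν z) * g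
ν-factorisation {z} z≢0 = from-∣∣ {λ z′ → ∃ λ g → OddInt g × z′ ≡ + (2 ^ ν z) * g} negate z
  (+ suc (ω z ℕ.* 2) , odd-* (ω z) ,
   trans (cong +_ (∣∣-factorisation z≢0)) (ℤ.pos-* (2 ^ ν z) (suc (ω z ℕ.* 2))))
  where
  negate : ∀ {z′} → (∃ λ g → OddInt g × z′ ≡ + (2 ^ ν z) * g) →
                    ∃ λ g → OddInt g × - z′ ≡ + (2 ^ ν z) * g
  negate (g , odd , z′≡) =
    - g , odd-neg odd , trans (cong (λ u → - u) z′≡) (ℤ.neg-distribʳ-* (+ (2 ^ ν z)) g)

ν-even : ∀ {z} → z ≢ + 0 → EvenInt z → ν z ≢ 0
ν-even z≢0 even ν≡0 with ν-factorisation z≢0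
... | g , odd , z≡ = even≢odd even
  (subst OddInt (sym (trans z≡ (trans (cong (λ e → + (2 ^ e) * g) ν≡0) (ℤ.*-identityˡ g)))) odd)

pow2-suc : ∀ e → ∃ λ d → 2 ^ e ≡ suc d
pow2-suc e with 2 ^ e | ℕₚ.m^n>0 2 e
... | suc d | _ = d , refl

split-powers : ∀ {e₁ e₂} → e₁ ≢ 0 → e₁ ℕ.< e₂ → ∀ O₁ O₂ →
  ∃₂ λ d c → 2 ^ e₁ ℕ.* O₁ ≡ suc d ℕ.* 2 ℕ.* O₁ × 2 ^ e₂ ℕ.* suc O₂ ≡ suc d ℕ.* 2 ℕ.* (suc c ℕ.* 2)
split-powers {zero} 0≢0 = ⊥-elim (0≢0 refl)
split-powers {suc b} _ e₁<e₂ O₁ O₂ with ℕₚ.m≤n⇒∃[o]m+o≡n e₁<e₂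
... | k , refl with pow2-suc b | pow2-suc k
...   | d , 2^b≡ | p , 2^k≡ = d , O₂ ℕ.+ p ℕ.* suc O₂ ,
  trans (swap (2 ^ b) O₁) (cong (λ a → a ℕ.* 2 ℕ.* O₁) 2^b≡) ,
  (begin
    2 ^ suc (suc (b ℕ.+ k)) ℕ.* suc O₂
      ≡⟨ cong (λ a → 2 ℕ.* (2 ℕ.* a) ℕ.* suc O₂) (ℕₚ.^-distribˡ-+-* 2 b k) ⟩
    2 ℕ.* (2 ℕ.* (2 ^ b ℕ.* 2 ^ k)) ℕ.* suc O₂
      ≡⟨ regroup (2 ^ b) (2 ^ k) (suc O₂) ⟩
    2 ^ b ℕ.* 2 ℕ.* (2 ^ k ℕ.* suc O₂ ℕ.* 2)
      ≡⟨ cong₂ (λ a a′ → a ℕ.* 2 ℕ.* (a′ ℕ.* suc O₂ ℕ.* 2)) 2^b≡ 2^k≡ ⟩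
    suc d ℕ.* 2 ℕ.* (suc p ℕ.* suc O₂ ℕ.* 2) ∎)
  where
  open ≡-Reasoning
  swap : ∀ a o → 2 ℕ.* a ℕ.* o ≡ a ℕ.* 2 ℕ.* o
  swap = ℕ-Solver.solve-∀
  regroup : ∀ a a′ o → 2 ℕ.* (2 ℕ.* (a ℕ.* a′)) ℕ.* o ≡ a ℕ.* 2 ℕ.* (a′ ℕ.* o ℕ.* 2)
  regroup = ℕ-Solver.solve-∀

twoValued-below : ∀ {x y} → + 0 < x → y < + 0 → EvenInt y → ν y ℕ.< ν x → TwoValued x y
twoValued-below {x} {y} 0<x y<0 even-y νy<νx =
  from-split (split-powers (ν-even (ℤ.<⇒≢ y<0) even-y) νy<νx (suc (ω y ℕ.* 2)) (ω x ℕ.* 2))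
  where
  from-split : (∃₂ λ d c → 2 ^ ν y ℕ.* suc (ω y ℕ.* 2) ≡ suc d ℕ.* 2 ℕ.* suc (ω y ℕ.* 2)
                         × 2 ^ ν x ℕ.* suc (ω x ℕ.* 2) ≡ suc d ℕ.* 2 ℕ.* (suc c ℕ.* 2)) → TwoValued x y
  from-split (d , c , ∣y∣≡ , ∣x∣≡) = subst₂ TwoValued
    (trans (cong +_ (sym (trans (∣∣-factorisation (≢-sym (ℤ.<⇒≢ 0<x))) ∣x∣≡))) (ℤ.0≤i⇒+∣i∣≡i (ℤ.<⇒≤ 0<x)))
    (trans (cong (λ n → - + n) (sym (trans (∣∣-factorisation (ℤ.<⇒≢ y<0)) ∣y∣≡))) (<0⇒-+∣∣ y<0))
    (twoValued d (ω y) c)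

twoValued-above : ∀ {x y} → + 0 < x → y < + 0 → EvenInt x → ν x ℕ.< ν y → TwoValued x y
twoValued-above {x} {y} 0<x y<0 even-x νx<νy =
  from-split (split-powers (ν-even (≢-sym (ℤ.<⇒≢ 0<x)) even-x) νx<νy (suc (ω x ℕ.* 2)) (ω y ℕ.* 2))
  where
  from-split : (∃₂ λ d c → 2 ^ ν x ℕ.* suc (ω x ℕ.* 2) ≡ suc d ℕ.* 2 ℕ.* suc (ω x ℕ.* 2)
                         × 2 ^ ν y ℕ.* suc (ω y ℕ.* 2) ≡ suc d ℕ.* 2 ℕ.* (suc c ℕ.* 2)) → TwoValued x y
  from-split (d , c , ∣x∣≡ , ∣y∣≡) = subst₂ TwoValued
    (trans (ℤ.neg-involutive _) (trans (cong +_ (sym (trans (∣∣-factorisation (≢-sym (ℤ.<⇒≢ 0<x))) ∣x∣≡)))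
                                         (ℤ.0≤i⇒+∣i∣≡i (ℤ.<⇒≤ 0<x))))
    (trans (cong (λ n → - + n) (sym (trans (∣∣-factorisation (ℤ.<⇒≢ y<0)) ∣y∣≡))) (<0⇒-+∣∣ y<0))
    (TwoValued-swap (twoValued d (ω x) c))

twoValued-from-valuations : ∀ {x y} → + 0 < x → y < + 0 → EvenInt x → EvenInt y → ν x ≢ ν y → TwoValued x y
twoValued-from-valuations {x} {y} 0<x y<0 even-x even-y νx≢νy = by-comparison (ℕₚ.<-cmp (ν x) (ν y))
  where
  by-comparison : Tri (ν x ℕ.< ν y) (ν x ≡ ν y) (ν y ℕ.< ν x) → TwoValued x y
  by-comparison (tri< νx<νy _ _) = twoValued-above 0<x y<0 even-x νx<νy
  by-comparison (tri≈ _ νx≡νy _) = ⊥-elim (νx≢νy νx≡νy)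
  by-comparison (tri> _ _ νy<νx) = twoValued-below 0<x y<0 even-y νy<νx

equal-valuations-impossible : ∀ {k E} (T : Tournament (suc k)) →
  (∀ v → imb T v ≢ + 0) → (∀ v → EvenInt (imb T v)) → (∀ v → ν (imb T v) ≡ E) → ⊥
equal-valuations-impossible {k} {E} T nonzero even same = even≢odd order-even order-odd
  where
  g : Fin (suc k) → ℤ
  g v = proj₁ (ν-factorisation (nonzero v))
  imb≡ : ∀ v → imb T v ≡ + (2 ^ E) * g v
  imb≡ v = trans (proj₂ (proj₂ (ν-factorisation (nonzero v)))) (cong (λ e → + (2 ^ e) * g v) (same v))
  2^E*sum≡0 : + (2 ^ E) * sum g ≡ + 0
  2^E*sum≡0 = trans (*-distribˡ-sum (+ (2 ^ E)) g) (trans (sum-cong-≗ (sym ∘ imb≡)) (sum-imb T))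
  sum≡0 : (+ (2 ^ E) ≡ + 0) ⊎ (sum g ≡ + 0) → sum g ≡ + 0
  sum≡0 (inj₁ 2^E≡0) = ⊥-elim (ℕₚ.<-irrefl (sym (ℤ.+-injective 2^E≡0)) (ℕₚ.m^n>0 2 E))
  sum≡0 (inj₂ sum≡0) = sum≡0
  order-even : EvenInt (+ suc k)
  order-even = let (m , sum≡) = sum-odd g (λ v → proj₁ (proj₂ (ν-factorisation (nonzero v)))) in
    - m , trans (cancel (+ suc k) m)
      (trans (cong (_+ + 2 * - m) (trans (sym sum≡) (sum≡0 (ℤ.i*j≡0⇒i≡0∨j≡0 (+ (2 ^ E)) 2^E*sum≡0))))
             (ℤ.+-identityˡ _))
    where
    cancel : ∀ n m → n ≡ n + + 2 * m + + 2 * - m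
    cancel = solve-∀
  order-odd : OddInt (+ suc k)
  order-odd = let (t , k≡2t) = even-imb⇒odd-order T zero (even zero) in t , cong (_+_ (+ 1)) k≡2t

module _ {Z : List ℤ} (R : Realizable Z) where
  private
    k = proj₁ R
    T₀ = proj₁ (proj₂ R)
    imbalances = proj₂ (proj₂ R)

  imb∈ : ∀ v → imb T₀ v ∈ Z
  imb∈ v = Equivalence.from (imbalances _) (v , imbalance≡imb T₀ v)

  ∈⇒imb : ∀ {z} → z ∈ Z → ∃ λ v → imb T₀ v ≡ z
  ∈⇒imb {z} z∈Z = let (v , e) = Equivalence.to (imbalances z) z∈Z in v , trans (sym (imbalance≡imb T₀ v)) e

  inhabited : ∃ λ z → z ∈ Z
  inhabited = imb T₀ zero , imb∈ zero

  positive⇒negative : ∀ {z} → z ∈ Z → + 0 < z → ∃ λ y → y ∈ Z × y < + 0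
  positive⇒negative z∈Z 0<z =
    let (v , e) = ∈⇒imb z∈Z
        (w , w<0) = sum≡0⇒negative (imb T₀) (sum-imb T₀) v (subst (+ 0 <_) (sym e) 0<z)
    in imb T₀ w , imb∈ w , w<0

  negative⇒positive : ∀ {z} → z ∈ Z → z < + 0 → ∃ λ x → x ∈ Z × + 0 < x
  negative⇒positive z∈Z z<0 =
    let (v , e) = ∈⇒imb z∈Z
        (w , 0<w) = sum≡0⇒positive (imb T₀) (sum-imb T₀) v (subst (_< + 0) (sym e) z<0)
    in imb T₀ w , imb∈ w , 0<w

∈-nonneg⁺ : ∀ {Z z} → z ∈ Z → + 0 ≤ z → z ∈ nonneg Z
∈-nonneg⁺ z∈Z 0≤z = ∈ₚ.∈-filter⁺ (T? ∘ (+ 0 ≤ᵇ_)) z∈Z (ℤ.≤⇒≤ᵇ 0≤z)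

∈-nonneg⁻ : ∀ {Z z} → z ∈ nonneg Z → z ∈ Z × + 0 ≤ z
∈-nonneg⁻ {Z} z∈X = map₂ ℤ.≤ᵇ⇒≤ (∈ₚ.∈-filter⁻ (T? ∘ (+ 0 ≤ᵇ_)) {xs = Z} z∈X)

∈-neg⁺ : ∀ {Z z} → z ∈ Z → z < + 0 → z ∈ neg Z
∈-neg⁺ { z = -[1+ n ]} z∈Z _ = ∈ₚ.∈-filter⁺ (T? ∘ not ∘ (+ 0 ≤ᵇ_)) z∈Z tt
∈-neg⁺ {z = + n} _ (+<+ ())

∈-neg⁻ : ∀ {Z z} → z ∈ neg Z → z ∈ Z × z < + 0
∈-neg⁻ {Z} {z} z∈Y = map₂ negative (∈ₚ.∈-filter⁻ (T? ∘ not ∘ (+ 0 ≤ᵇ_)) {xs = Z} z∈Y)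
  where
  negative : ∀ {z} → T (not (+ 0 ≤ᵇ z)) → z < + 0
  negative { -[1+ n ]} _ = -<+

allPairs : List ℤ → List (ℤ × ℤ)
allPairs Z = cartesianProduct (nonneg Z) (neg Z)

∈-allPairs⁺ : ∀ {Z x y} → x ∈ Z → + 0 ≤ x → y ∈ Z → y < + 0 → (x , y) ∈ allPairs Z
∈-allPairs⁺ x∈Z 0≤x y∈Z y<0 = ∈ₚ.∈-cartesianProduct⁺ (∈-nonneg⁺ x∈Z 0≤x) (∈-neg⁺ y∈Z y<0)

∈-allPairs⁻ : ∀ {Z x y} → (x , y) ∈ allPairs Z → (x ∈ Z × + 0 ≤ x) × (y ∈ Z × y < + 0)
∈-allPairs⁻ {Z} xy∈ = let (x∈X , y∈Y) = ∈ₚ.∈-cartesianProduct⁻ (nonneg Z) (neg Z) xy∈ in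
  ∈-nonneg⁻ x∈X , ∈-neg⁻ y∈Y

difference : ℤ × ℤ → ℤ
difference (x , y) = x - y

sumℤ-++ : ∀ {A : Set} (f : A → ℤ) xs ys → sumℤ (map f (xs List.++ ys)) ≡ sumℤ (map f xs) + sumℤ (map f ys)
sumℤ-++ f [] ys = sym (ℤ.+-identityˡ _)
sumℤ-++ f (x ∷ xs) ys = trans (cong (_+_ (f x)) (sumℤ-++ f xs ys)) (sym (ℤ.+-assoc (f x) _ _))

sumℤ-cong : ∀ {A : Set} (f g : A → ℤ) xs → (∀ {a} → a ∈ xs → f a ≡ g a) → sumℤ (map f xs) ≡ sumℤ (map g xs)
sumℤ-cong f g [] f≡g = refl
sumℤ-cong f g (x ∷ xs) f≡g = cong₂ _+_ (f≡g (here refl)) (sumℤ-cong f g xs (f≡g ∘ there))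

0≤sumℤ : ∀ {A : Set} (f : A → ℤ) xs → (∀ {a} → a ∈ xs → + 0 ≤ f a) → + 0 ≤ sumℤ (map f xs)
0≤sumℤ f [] _ = ℤ.≤-refl
0≤sumℤ f (x ∷ xs) 0≤f = ℤ.+-mono-≤ (0≤f (here refl)) (0≤sumℤ f xs (0≤f ∘ there))

sum-differences : ∀ X Y → sumℤ (map difference (cartesianProduct X Y)) ≡ + length Y * sumℤ X - + length X * sumℤ Y
sum-differences [] Y = sym (vanish (+ length Y) (sumℤ Y))
  where
  vanish : ∀ m s → m * + 0 - + 0 * s ≡ + 0
  vanish = solve-∀
sum-differences (x ∷ X) Y = begin
  sumℤ (map difference (map (x ,_) Y List.++ cartesianProduct X Y))
    ≡⟨ sumℤ-++ difference (map (x ,_) Y) (cartesianProduct X Y) ⟩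
  sumℤ (map difference (map (x ,_) Y)) + sumℤ (map difference (cartesianProduct X Y))
    ≡⟨ cong₂ _+_ (row Y) (sum-differences X Y) ⟩
  (+ length Y * x - sumℤ Y) + (+ length Y * sumℤ X - + length X * sumℤ Y)
    ≡⟨ regroup (+ length Y) x (sumℤ Y) (sumℤ X) (+ length X) ⟩
  + length Y * (x + sumℤ X) - (+ 1 + + length X) * sumℤ Y ∎
  where
  open ≡-Reasoning
  regroup : ∀ m x s S l → (m * x - s) + (m * S - l * s) ≡ m * (x + S) - (+ 1 + l) * s
  regroup = solve-∀
  row : ∀ Y → sumℤ (map difference (map (x ,_) Y)) ≡ + length Y * x - sumℤ Y
  row [] = sym (ℤ.*-zeroˡ x)
  row (y ∷ Y) = trans (cong (_+_ (x - y)) (row Y)) (step x y (+ length Y) (sumℤ Y))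
    where
    step : ∀ x y m s → x - y + (m * x - s) ≡ (+ 1 + m) * x - (y + s)
    step = solve-∀

nOf≡ : ∀ Z → nOf Z ≡ sumℤ (map difference (allPairs Z))
nOf≡ Z = trans (swap (+ lX Z) (sumℤ (neg Z)) (+ mY Z) (sumℤ (nonneg Z)))
                (sym (sum-differences (nonneg Z) (neg Z)))
  where
  swap : ∀ l sY m sX → l * - sY + m * sX ≡ m * sX - l * sY
  swap = solve-∀

module _ {A : Set} (xs ys : List A) (v : A) where

  ∈-++-insert : ∀ {u} → u ∈ xs List.++ ys → u ∈ xs List.++ v ∷ ys
  ∈-++-insert u∈ with ∈ₚ.∈-++⁻ xs u∈
  ... | inj₁ u∈xs = ∈ₚ.∈-++⁺ˡ u∈xs
  ... | inj₂ u∈ys = ∈ₚ.∈-++⁺ʳ xs (there u∈ys)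

  ∈-++-remove : ∀ {u} → u ∈ xs List.++ v ∷ ys → u ≢ v → u ∈ xs List.++ ys
  ∈-++-remove u∈ u≢v with ∈ₚ.∈-++⁻ xs u∈
  ... | inj₁ u∈xs = ∈ₚ.∈-++⁺ˡ u∈xs
  ... | inj₂ (here u≡v) = ⊥-elim (u≢v u≡v)
  ... | inj₂ (there u∈ys) = ∈ₚ.∈-++⁺ʳ xs u∈ys

  sumℤ-++-insert : ∀ (f : A → ℤ) → sumℤ (map f (xs List.++ v ∷ ys)) ≡ sumℤ (map f (xs List.++ ys)) + f v
  sumℤ-++-insert f = begin
    sumℤ (map f (xs List.++ v ∷ ys))        ≡⟨ sumℤ-++ f xs (v ∷ ys) ⟩
    sumℤ (map f xs) + (f v + sumℤ (map f ys)) ≡⟨ regroup (sumℤ (map f xs)) (f v) (sumℤ (map f ys)) ⟩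
    sumℤ (map f xs) + sumℤ (map f ys) + f v ≡⟨ cong (_+ f v) (sym (sumℤ-++ f xs ys)) ⟩
    sumℤ (map f (xs List.++ ys)) + f v      ∎
    where
    open ≡-Reasoning
    regroup : ∀ a b c → a + (b + c) ≡ a + c + b
    regroup = solve-∀

ord≤ : ∀ {Z o K} → IsOrd Z o → (T : Tournament K) → IsImbalanceSetOf Z T → Fin K → o ℕ.≤ K
ord≤ {K = suc K} (_ , minimal) T imbalances _ = minimal K T imbalances

ord≤order : ∀ {Z o w} → IsOrd Z o → (D : Design (+ 0) w) → (∀ v → target D v ∈ Z) →
  (∀ {z} → z ∈ Z → Attains D z) → ∀ {z} → z ∈ Z → o ℕ.≤ order D
ord≤order {Z} isOrd D targets∈ attains z∈Z = ord≤ isOrd (tournament D) imbalances (proj₁ (attains z∈Z))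
  where
  imbalance≡target : ∀ v → imbalance (tournament D) v ≡ target D v
  imbalance≡target v = trans (imbalance≡imb (tournament D) v) (imb≡target D v)
  imbalances : IsImbalanceSetOf Z (tournament D)
  imbalances z = mk⇔
    (λ z∈Z → let (v , e) = attains z∈Z in v , trans (imbalance≡target v) e)
    (λ (v , e) → subst (_∈ Z) (trans (sym (imbalance≡target v)) e) (targets∈ v))

record Realises {s w} (D : Design s w) (x y : ℤ) : Set where
  field
    targets   : ∀ v → target D v ≡ x ⊎ target D v ≡ y
    order≡    : + order D ≡ x - y
    attains-x : Attains D x
    attains-y : x ≢ + 0 → Attains D y

bipartite-realises : ∀ {s w₁ w₂ x y} (D : Design s w₁) (E : Design s w₂) →
  (∀ a → target D a ≡ + 0) → (∀ b → target E b ≡ + 0) →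
  + order E ≡ x → - + order D ≡ y → Fin (order D) → (x ≢ + 0 → Fin (order E)) →
  Realises (bipartite D E) x y
bipartite-realises {x = x} {y} D E D≡0 E≡0 ∣E∣≡x -∣D∣≡y a x≢0⇒b = record
  { targets = λ v →
      Sum.map (λ t≡ → trans t≡ ∣E∣≡x) (λ t≡ → trans t≡ -∣D∣≡y) (bipartite-targets D E D≡0 E≡0 v)
  ; order≡ = trans (ℤ.pos-+ (order D) (order E))
                   (trans (swap (+ order D) (+ order E)) (cong₂ _-_ ∣E∣≡x -∣D∣≡y))
  ; attains-x = map₂ (λ t≡ → trans t≡ ∣E∣≡x) (bipartite-attainsˡ D E D≡0 E≡0 a)
  ; attains-y = λ x≢0 → map₂ (λ t≡ → trans t≡ -∣D∣≡y) (bipartite-attainsʳ D E D≡0 E≡0 (x≢0⇒b x≢0))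
  }
  where
  swap : ∀ p q → p + q ≡ q - - p
  swap = solve-∀

record Gadgets (Z : List ℤ) (s : ℤ) : Set where
  field
    gadget   : ℤ × ℤ → Design s (+ 0)
    realises : ∀ {x y} → (x , y) ∈ allPairs Z → Realises (gadget (x , y)) x y

oddGadgets : ∀ {Z} → All OddInt Z → Gadgets Z (+ 0)
oddGadgets {Z} odd = record
  { gadget = λ (x , y) → bipartite (regularᴰ ⌊ ∣ y ∣ /2⌋) (flipLabels (regularᴰ ⌊ ∣ x ∣ /2⌋))
  ; realises = λ {x} {y} xy∈ →
      let ((x∈Z , 0≤x) , (y∈Z , y<0)) = ∈-allPairs⁻ xy∈ in
      bipartite-realises (regularᴰ ⌊ ∣ y ∣ /2⌋) (flipLabels (regularᴰ ⌊ ∣ x ∣ /2⌋)) (λ _ → refl) (λ _ → refl)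
        (trans (cong +_ (sym (odd-∣∣ (All.lookup odd x∈Z)))) (ℤ.0≤i⇒+∣i∣≡i 0≤x))
        (trans (cong (λ n → - + n) (sym (odd-∣∣ (All.lookup odd y∈Z)))) (<0⇒-+∣∣ y<0))
        zero (λ _ → zero)
  }

even-vertex : ∀ {z} → z ≢ + 0 → EvenInt z → Fin (⌊ ∣ z ∣ /2⌋ ℕ.* 2)
even-vertex {z} z≢0 even with ⌊ ∣ z ∣ /2⌋ | even-∣∣ even
... | zero | ∣z∣≡0 = ⊥-elim (z≢0 (ℤ.∣i∣≡0⇒i≡0 ∣z∣≡0))
... | suc h | _ = zero

evenGadgets : ∀ {Z} → All EvenInt Z → Gadgets Z (- + 1)
evenGadgets {Z} even = record
  { gadget = λ (x , y) → bipartite (nearRegularᴰ ⌊ ∣ y ∣ /2⌋) (nearRegularᴰ ⌊ ∣ x ∣ /2⌋)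
  ; realises = λ {x} {y} xy∈ →
      let ((x∈Z , 0≤x) , (y∈Z , y<0)) = ∈-allPairs⁻ xy∈ in
      bipartite-realises (nearRegularᴰ ⌊ ∣ y ∣ /2⌋) (nearRegularᴰ ⌊ ∣ x ∣ /2⌋) (λ _ → refl) (λ _ → refl)
        (trans (cong +_ (sym (even-∣∣ (All.lookup even x∈Z)))) (ℤ.0≤i⇒+∣i∣≡i 0≤x))
        (trans (cong (λ n → - + n) (sym (even-∣∣ (All.lookup even y∈Z)))) (<0⇒-+∣∣ y<0))
        (even-vertex (ℤ.<⇒≢ y<0) (All.lookup even y∈Z))
        (λ x≢0 → even-vertex x≢0 (All.lookup even x∈Z))
  }

module PairDesigns {Z s w} (Γ : Gadgets Z s) (P : List (ℤ × ℤ)) (P⊆ : ∀ {pr} → pr ∈ P → pr ∈ allPairs Z)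
                (E : Design (s + w) w) where
  open Gadgets Γ

  D : Design (s + w) w
  D = foldr-⊕ gadget P E

  targets∈ : (∀ v → target E v ∈ Z) → ∀ v → target D v ∈ Z
  targets∈ E∈Z v = from (foldr-⊕-targets gadget E P v)
    where
    from : (∃ λ pr → pr ∈ P × Attains (gadget pr) (target D v)) ⊎ Attains E (target D v) → target D v ∈ Z
    from (inj₂ (u , e)) = subst (_∈ Z) e (E∈Z u)
    from (inj₁ ((x , y) , xy∈P , u , e))
      with ∈-allPairs⁻ (P⊆ xy∈P) | Realises.targets (realises (P⊆ xy∈P)) u
    ... | (x∈Z , _) , _ | inj₁ t≡x = subst (_∈ Z) (trans (sym t≡x) e) x∈Z
    ... | _ , (y∈Z , _) | inj₂ t≡y = subst (_∈ Z) (trans (sym t≡y) e) y∈Z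

  order≡ : + order D ≡ sumℤ (map difference P) + + order E
  order≡ = trans (order-foldr-⊕ gadget E P)
    (cong (_+ + order E) (sumℤ-cong _ difference P (Realises.order≡ ∘ realises ∘ P⊆)))

  attains-x : ∀ {x y} → (x , y) ∈ P → Attains D x
  attains-x xy∈P = foldr-⊕-attainsᴳ gadget E xy∈P (Realises.attains-x (realises (P⊆ xy∈P)))

  attains-y : ∀ {x y} → (x , y) ∈ P → x ≢ + 0 → Attains D y
  attains-y xy∈P x≢0 = foldr-⊕-attainsᴳ gadget E xy∈P (Realises.attains-y (realises (P⊆ xy∈P)) x≢0)

  attains-E : ∀ {t} → Attains E t → Attains D t
  attains-E = foldr-⊕-attainsᴱ gadget E {P}

  attains-nonzero : Realizable Z → (∀ {pr} → pr ∈ allPairs Z → pr ∈ P) →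
    ∀ {z} → z ∈ Z → z ≢ + 0 → Attains D z
  attains-nonzero R P⊇ {z} z∈Z z≢0 with + 0 ℤ.≤? z
  ... | yes 0≤z = let (y , y∈Z , y<0) = positive⇒negative R z∈Z (ℤ.≤∧≢⇒< 0≤z (≢-sym z≢0)) in
    attains-x (P⊇ (∈-allPairs⁺ z∈Z 0≤z y∈Z y<0))
  ... | no 0≰z = let (x , x∈Z , 0<x) = negative⇒positive R z∈Z (ℤ.≰⇒> 0≰z) in
    attains-y (P⊇ (∈-allPairs⁺ x∈Z (ℤ.<⇒≤ 0<x) z∈Z (ℤ.≰⇒> 0≰z))) (≢-sym (ℤ.<⇒≢ 0<x))

ord≤n : ∀ {Z o} → Realizable Z → IsOrd Z o → All OddInt Z → + o ≤ nOf Z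
ord≤n {Z} {o} R isOrd odd = begin
  + o
    ≤⟨ +≤+ (ord≤order isOrd D (targets∈ λ ()) attains (proj₂ (inhabited R))) ⟩
  + order D
    ≡⟨ order≡ ⟩
  sumℤ (map difference (allPairs Z)) + + 0
    ≡⟨ ℤ.+-identityʳ _ ⟩
  sumℤ (map difference (allPairs Z))
    ≡⟨ sym (nOf≡ Z) ⟩
  nOf Z ∎
  where
  open ℤ.≤-Reasoning
  open PairDesigns (oddGadgets odd) (allPairs Z) id ∅
  attains : ∀ {z} → z ∈ Z → Attains D z
  attains z∈Z = attains-nonzero R id z∈Z (odd≢0 (All.lookup odd z∈Z))

ord≤n+1 : ∀ {Z o} → Realizable Z → IsOrd Z o → All EvenInt Z → + 0 ∈ Z → + o ≤ nOf Z + + 1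
ord≤n+1 {Z} {o} R isOrd even 0∈Z = begin
  + o
    ≤⟨ +≤+ (ord≤order isOrd D (targets∈ λ _ → 0∈Z) attains 0∈Z) ⟩
  + order D
    ≡⟨ order≡ ⟩
  sumℤ (map difference (allPairs Z)) + + 1
    ≡⟨ cong (_+ + 1) (sym (nOf≡ Z)) ⟩
  nOf Z + + 1 ∎
  where
  open ℤ.≤-Reasoning
  open PairDesigns (evenGadgets even) (allPairs Z) id (regularᴰ 0)
  attains : ∀ {z} → z ∈ Z → Attains D z
  attains {z} z∈Z with z ℤ.≟ + 0
  ... | yes refl = attains-E (zero , refl)
  ... | no z≢0 = attains-nonzero R id z∈Z z≢0

opposite-signs : ∀ {Z} → Realizable Z → + 0 ∉ Z → ∃₂ λ x y → (x ∈ Z × + 0 < x) × (y ∈ Z × y < + 0)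
opposite-signs {Z} R 0∉Z = by-sign (+ 0 ℤ.≤? z)
  where
  z = proj₁ (inhabited R)
  z∈Z = proj₂ (inhabited R)
  by-sign : Dec (+ 0 ≤ z) → ∃₂ λ x y → (x ∈ Z × + 0 < x) × (y ∈ Z × y < + 0)
  by-sign (yes 0≤z) = let 0<z = ℤ.≤∧≢⇒< 0≤z (λ 0≡z → 0∉Z (subst (_∈ Z) (sym 0≡z) z∈Z))
                          (y , y∈Z , y<0) = positive⇒negative R z∈Z 0<z in
    z , y , (z∈Z , 0<z) , (y∈Z , y<0)
  by-sign (no 0≰z) = let (x , x∈Z , 0<x) = negative⇒positive R z∈Z (ℤ.≰⇒> 0≰z) in
    x , z , (x∈Z , 0<x) , (z∈Z , ℤ.≰⇒> 0≰z)

distinct-valuations : ∀ {Z} → Realizable Z → All EvenInt Z → + 0 ∉ Z →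
  ∃ λ pr → pr ∈ allPairs Z × ν (proj₁ pr) ≢ ν (proj₂ pr)
distinct-valuations {Z} R even 0∉Z = decide (All.all? ν-equal? (allPairs Z))
  where
  ν-equal? : ∀ pr → Dec (ν (proj₁ pr) ≡ ν (proj₂ pr))
  ν-equal? pr = ν (proj₁ pr) ℕ.≟ ν (proj₂ pr)
  T₀ = proj₁ (proj₂ R)
  decide : Dec (All (λ pr → ν (proj₁ pr) ≡ ν (proj₂ pr)) (allPairs Z)) →
    ∃ λ pr → pr ∈ allPairs Z × ν (proj₁ pr) ≢ ν (proj₂ pr)
  decide (no ¬all) = find (¬All⇒Any¬ ν-equal? (allPairs Z) ¬all)
  decide (yes all) = ⊥-elim (equal-valuations-impossible T₀ nonzero (λ v → All.lookup even (imb∈ R v)) same)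
    where
    x₁ = proj₁ (opposite-signs R 0∉Z)
    y₁ = proj₁ (proj₂ (opposite-signs R 0∉Z))
    x₁∈ = proj₁ (proj₂ (proj₂ (opposite-signs R 0∉Z)))
    y₁∈ = proj₂ (proj₂ (proj₂ (opposite-signs R 0∉Z)))
    nonzero : ∀ v → imb T₀ v ≢ + 0
    nonzero v imb≡0 = 0∉Z (subst (_∈ Z) imb≡0 (imb∈ R v))
    same-sign : ∀ {z} → z ∈ Z → Dec (+ 0 ≤ z) → ν z ≡ ν y₁
    same-sign z∈Z (yes 0≤z) = All.lookup all (∈-allPairs⁺ z∈Z 0≤z (proj₁ y₁∈) (proj₂ y₁∈))
    same-sign z∈Z (no 0≰z) = trans
      (sym (All.lookup all (∈-allPairs⁺ (proj₁ x₁∈) (ℤ.<⇒≤ (proj₂ x₁∈)) z∈Z (ℤ.≰⇒> 0≰z))))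
      (All.lookup all (∈-allPairs⁺ (proj₁ x₁∈) (ℤ.<⇒≤ (proj₂ x₁∈)) (proj₁ y₁∈) (proj₂ y₁∈)))
    same : ∀ v → ν (imb T₀ v) ≡ ν y₁
    same v = same-sign (imb∈ R v) (+ 0 ℤ.≤? imb T₀ v)

module WithoutZero {Z} (R : Realizable Z) (even : All EvenInt Z) (0∉Z : + 0 ∉ Z) where

  chosen : ∃ λ pr → pr ∈ allPairs Z × ν (proj₁ pr) ≢ ν (proj₂ pr)
  chosen = distinct-valuations R even 0∉Z

  x₀ y₀ : ℤ
  x₀ = proj₁ (proj₁ chosen)
  y₀ = proj₂ (proj₁ chosen)

  pr₀∈ : (x₀ , y₀) ∈ allPairs Z
  pr₀∈ = proj₁ (proj₂ chosen)

  x₀∈Z : x₀ ∈ Z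
  x₀∈Z = proj₁ (proj₁ (∈-allPairs⁻ {Z} pr₀∈))

  y₀∈Z : y₀ ∈ Z
  y₀∈Z = proj₁ (proj₂ (∈-allPairs⁻ {Z} pr₀∈))

  y₀<0 : y₀ < + 0
  y₀<0 = proj₂ (proj₂ (∈-allPairs⁻ {Z} pr₀∈))

  0<x₀ : + 0 < x₀
  0<x₀ = ℤ.≤∧≢⇒< (proj₂ (proj₁ (∈-allPairs⁻ {Z} pr₀∈)))
                  (λ 0≡x₀ → 0∉Z (subst (_∈ Z) (sym 0≡x₀) x₀∈Z))

  module Q = TwoValued (twoValued-from-valuations 0<x₀ y₀<0 (All.lookup even x₀∈Z) (All.lookup even y₀∈Z)
                                                   (proj₂ (proj₂ chosen)))

  split : ∃₂ λ P₁ P₂ → allPairs Z ≡ P₁ List.++ (x₀ , y₀) ∷ P₂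
  split = ∈ₚ.∈-∃++ pr₀∈

  P₁ P₂ : List (ℤ × ℤ)
  P₁ = proj₁ split
  P₂ = proj₁ (proj₂ split)

  P⊆ : ∀ {pr} → pr ∈ P₁ List.++ P₂ → pr ∈ allPairs Z
  P⊆ {pr} = subst (pr ∈_) (sym (proj₂ (proj₂ split))) ∘ ∈-++-insert P₁ P₂ (x₀ , y₀)

  open PairDesigns (evenGadgets even) (P₁ List.++ P₂) P⊆ Q.design public

  Q-targets∈ : ∀ v → target Q.design v ∈ Z
  Q-targets∈ v = Sum.[ (λ t≡x₀ → subst (_∈ Z) (sym t≡x₀) x₀∈Z)
                     , (λ t≡y₀ → subst (_∈ Z) (sym t≡y₀) y₀∈Z) ]′ (Q.targets v)

  other-pair : ∀ {x y} → (x , y) ∈ allPairs Z → (x , y) ≢ (x₀ , y₀) → (x , y) ∈ P₁ List.++ P₂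
  other-pair {x} {y} xy∈ ≢pr₀ =
    ∈-++-remove P₁ P₂ (x₀ , y₀) (subst ((x , y) ∈_) (proj₂ (proj₂ split)) xy∈) ≢pr₀

  attains-other : ∀ {z} → z ∈ Z → z ≢ x₀ → z ≢ y₀ → Dec (+ 0 ≤ z) → Attains D z
  attains-other z∈Z z≢x₀ _ (yes 0≤z) =
    attains-x (other-pair (∈-allPairs⁺ z∈Z 0≤z y₀∈Z y₀<0) (z≢x₀ ∘ cong proj₁))
  attains-other z∈Z _ z≢y₀ (no 0≰z) =
    attains-y (other-pair (∈-allPairs⁺ x₀∈Z (ℤ.<⇒≤ 0<x₀) z∈Z (ℤ.≰⇒> 0≰z)) (z≢y₀ ∘ cong proj₂))
              (≢-sym (ℤ.<⇒≢ 0<x₀))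

  attains-by : ∀ {z} → z ∈ Z → Dec (z ≡ x₀) → Dec (z ≡ y₀) → Attains D z
  attains-by _ (yes refl) _ = attains-E Q.attains-x
  attains-by _ (no _) (yes refl) = attains-E Q.attains-y
  attains-by {z} z∈Z (no z≢x₀) (no z≢y₀) = attains-other z∈Z z≢x₀ z≢y₀ (+ 0 ℤ.≤? z)

  attains : ∀ {z} → z ∈ Z → Attains D z
  attains {z} z∈Z = attains-by z∈Z (z ℤ.≟ x₀) (z ℤ.≟ y₀)

  S : ℤ
  S = sumℤ (map difference (P₁ List.++ P₂))

  n≡S+x₀-y₀ : nOf Z ≡ S + (x₀ - y₀)
  n≡S+x₀-y₀ = trans (nOf≡ Z) (trans (cong (sumℤ ∘ map difference) (proj₂ (proj₂ split)))
                                     (sumℤ-++-insert P₁ P₂ (x₀ , y₀) difference))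

  S≤S+S : S ≤ S + S
  S≤S+S = ℤ.≤-trans (ℤ.≤-reflexive (sym (ℤ.+-identityʳ S))) (ℤ.+-monoʳ-≤ S 0≤S)
    where
    0≤S : + 0 ≤ S
    0≤S = 0≤sumℤ difference (P₁ List.++ P₂) λ xy∈ →
      let ((_ , 0≤x) , (_ , y<0)) = ∈-allPairs⁻ {Z} (P⊆ xy∈)
      in ℤ.+-mono-≤ 0≤x (ℤ.<⇒≤ (ℤ.neg-mono-< y<0))

ord<2n : ∀ {Z o} → Realizable Z → IsOrd Z o → All EvenInt Z → + 0 ∉ Z → + o < + 2 * nOf Z
ord<2n {Z} {o} R isOrd even 0∉Z = begin-strict
  + o                             ≤⟨ +≤+ (ord≤order isOrd D (targets∈ Q-targets∈) attains x₀∈Z) ⟩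
  + order D                       ≡⟨ order≡ ⟩
  S + + order Q.design            <⟨ ℤ.+-monoʳ-< S Q.order< ⟩
  S + + 2 * (x₀ - y₀)             ≤⟨ ℤ.+-monoˡ-≤ (+ 2 * (x₀ - y₀)) S≤S+S ⟩
  (S + S) + + 2 * (x₀ - y₀)       ≡⟨ double S (x₀ - y₀) ⟩
  + 2 * (S + (x₀ - y₀))           ≡⟨ cong (_*_ (+ 2)) (sym n≡S+x₀-y₀) ⟩
  + 2 * nOf Z                     ∎
  where
  open ℤ.≤-Reasoning
  open WithoutZero R even 0∉Z
  double : ∀ s d → (s + s) + + 2 * d ≡ + 2 * (s + d)
  double = solve-∀

-- Only membership in Z matters.
theorem4p5 : (Z : List ℤ) → Unique Z → Realizable Z → (o : ℕ) → IsOrd Z o →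
    (All OddInt Z → + o ≤ nOf Z)
    × (All EvenInt Z → + 0 ∈ Z → + o ≤ nOf Z + + 1)
    × (All EvenInt Z → + 0 ∉ Z → + o < + 2 * nOf Z)
theorem4p5 Z _ R o isOrd = ord≤n R isOrd , ord≤n+1 R isOrd , ord<2n R isOrd
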